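{- Let $n\ge 3$ and let $V$ be the set of all endpoints of the pairs $e_0,\dots,e_n$, where $e_l=\{\sigma(l,l+1,l+3),\sigma(l,l+2,l+3)\}$ for $0\le l\le n-3$, $e_{n-2}=\{\sigma(0,n-2,n-1),\sigma(0,n-2,n)\}$, $e_{n-1}=\{\sigma(1,n-1,n),\sigma(0,1,n-1)\}$, $e_n=\{\sigma(0,2,n),\sigma(1,2,n)\}$. Then every toric map $\bar f_r$ ($0\le r\le n$) and the reverse map $g$ map $V$ onto itself. If $n\ge 5$, then the toric-reverse group $\mathsf D_{n+1}$ acts regularly on $V$, and the subgraph $\Gamma(V)$ of $\mathrm{Cay}(\mathrm{Sym}_n,T_n)$ induced on $V$ is vertex-transitive.
   Context: $\mathrm{Sym}_n$ is the symmetric group on $[n]$, permutations in one-line notation, $(\pi\circ\rho)(t)=\pi(\rho(t))$. For $0\le i<j<k\le n$ the block transposition $\sigma(i,j,k)$ is $[1\cdots i\ \ j+1\cdots k\ \ i+1\cdots j\ \ k+1\cdots n]$; $T_n$ is the set of block transpositions; $\mathrm{Cay}(\mathrm{Sym}_n,T_n)$ has $\pi\sim\rho$ iff $\rho=\pi\circ\sigma$, $\sigma\in T_n$. For $\pi\in\mathrm{Sym}_n$ let $[0\,\pi]$ be the permutation of $\{0,\dots,n\}$ fixing $0$ and agreeing with $\pi$ on $[n]$; $\alpha:x\mapsto x+1\pmod{n+1}$. For $0\le r\le n$, $\bar f_r$ is defined by $[0\,\bar f_r(\pi)]=\alpha^{n+1-r}\circ[0\,\pi]\circ\alpha^{[0\,\pi]^{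 -1}(r)}$; $\bar f=\bar f_1$. The reverse map is $g(\pi)(t)=n+1-\pi(n+1-t)$. $\mathsf D_{n+1}$ is the group of permutations of $\mathrm{Sym}_n$ generated by $\bar f$ and $g$. -}

module Defs where

open import Data.Nat using (ℕ; zero; suc; _+_; _∸_; _≤_; _<_; _≟_)
open import Data.Nat.DivMod using (_%_)
open import Data.List using (List; []; _∷_; _++_; map; upTo; concatMap)
open import Data.List.Membership.Propositional using (_∈_)
open import Data.List.Relation.Binary.Permutation.Propositional using (_↭_)
open import Data.Product using (Σ; _×_; _,_; ∃)
open import Relation.Binary.PropositionalEquality using (_≡_)
open import Relation.Nullary using (yes; no)

-- A permutation π ∈ Sym_n is represented in one-line notation as the
-- list [π(1), π(2), …, π(n)] of natural numbers (values 1..n).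
-- The extended permutation [0 π] of {0,…,n} is the list 0 ∷ π,
-- read with 0-based positions.

-- [a .. b] (empty if b < a)
range : ℕ → ℕ → List ℕ
range a b = map (a +_) (upTo (suc b ∸ a))

-- 0-based lookup with default 0 (only used in range for permutations)
at : List ℕ → ℕ → ℕ
at []       _       = 0
at (x ∷ xs) zero    = x
at (x ∷ xs) (suc i) = at xs i

-- 0-based position of the first occurrence of r (inverse of a permutation
-- given in one-line notation)
pos : List ℕ → ℕ → ℕ
pos []       r = 0
pos (x ∷ xs) r with x ≟ r
... | yes _ = 0
... | no  _ = suc (pos xs r)

-- π(t), for t ∈ [n]; this is [0 π](t), and app π 0 = 0.
app : List ℕ → ℕ → ℕ
app π t = at (0 ∷ π) t

Sym : ℕ → List ℕ → Set
Sym n π = π ↭ range 1 n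

_∘ₚ_ : List ℕ → List ℕ → List ℕ
π ∘ₚ ρ = map (app π) ρ

-- block transposition σ(i,j,k) in Sym_n (meaningful for 0 ≤ i < j < k ≤ n)
σ : ℕ → ℕ → ℕ → ℕ → List ℕ
σ n i j k = range 1 i ++ range (suc j) k ++ range (suc i) j ++ range (suc k) n

Adj : ℕ → List ℕ → List ℕ → Set
Adj n π ρ = Σ ℕ λ i → Σ ℕ λ j → Σ ℕ λ k →
  (i < j) × (j < k) × (k ≤ n) × (ρ ≡ π ∘ₚ σ n i j k)

αpow : ℕ → ℕ → ℕ → ℕ
αpow n m x = (x + m) % suc n

-- toric map f̄_r :
-- [0 f̄_r(π)] = α^{n+1-r} ∘ [0 π] ∘ α^{[0 π]⁻¹(r)} ; f̄_r(π) is its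
-- restriction to positions 1..n.
fbar : ℕ → ℕ → List ℕ → List ℕ
fbar n r π =
  map (λ t → αpow n (suc n ∸ r) (app π (αpow n (pos (0 ∷ π) r) t))) (range 1 n)

grev : ℕ → List ℕ → List ℕ
grev n π = map (λ t → suc n ∸ app π (suc n ∸ t)) (range 1 n)

edges : ℕ → List (List ℕ × List ℕ)
edges n =
  map (λ l → (σ n l (l + 1) (l + 3) , σ n l (l + 2) (l + 3))) (upTo (n ∸ 2))
  ++ (σ n 0 (n ∸ 2) (n ∸ 1) , σ n 0 (n ∸ 2) n)
  ∷ (σ n 1 (n ∸ 1) n , σ n 0 1 (n ∸ 1))
  ∷ (σ n 0 2 n , σ n 1 2 n)
  ∷ []

V : ℕ → List (List ℕ)
V n = concatMap (λ { (a , b) → a ∷ b ∷ [] }) (edges n)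

-- Elements are represented by maps
-- List ℕ → List ℕ; two such maps denote the same element iff they agree on
-- Sym_n.
data InD (n : ℕ) : (List ℕ → List ℕ) → Set where
  gen-f : InD n (fbar n 1)
  gen-g : InD n (grev n)
  idD   : InD n (λ π → π)
  comp  : ∀ {d e} → InD n d → InD n e → InD n (λ π → d (e π))
  inv   : ∀ {d d'} → InD n d →
          (∀ π → Sym n π → d' (d π) ≡ π) →
          (∀ π → Sym n π → d (d' π) ≡ π) → InD n d'

MapsOnto : ℕ → (List ℕ → List ℕ) → Set
MapsOnto n h =
  (∀ π → π ∈ V n → h π ∈ V n) × (∀ ρ → ρ ∈ V n → Σ (List ℕ) λ π → π ∈ V n × h π ≡ ρ)

ActsRegularly : ℕ → Set
ActsRegularly n =
  (∀ v w → v ∈ V n → w ∈ V n → Σ (List ℕ → List ℕ) λ d → InD n d × d v ≡ w)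
  × (∀ d v → InD n d → v ∈ V n → d v ≡ v → ∀ π → Sym n π → d π ≡ π)

IsAutΓV : ℕ → (List ℕ → List ℕ) → Set
IsAutΓV n φ =
  MapsOnto n φ
  × (∀ x y → x ∈ V n → y ∈ V n → φ x ≡ φ y → x ≡ y)
  × (∀ x y → x ∈ V n → y ∈ V n → (Adj n x y → Adj n (φ x) (φ y)) × (Adj n (φ x) (φ y) → Adj n x y))

VertexTransitiveΓV : ℕ → Set
VertexTransitiveΓV n =
  ∀ v w → v ∈ V n → w ∈ V n → Σ (List ℕ → List ℕ) λ φ → IsAutΓV n φ × φ v ≡ w

-- Read [0 π] as a permutation of ℤ/(n+1).  Then f̄_r and g have the form x ↦ ±[0 π](±x + q) + c, so f̄_r = f̄^r,
-- f̄^(n+1) = g² = id and g f̄ g = f̄⁻¹: D_{n+1} = {f̄^a g^b} is dihedral.  Moreover f̄(π ∘ σ) = f̄(π) ∘ f̄^p(σ) and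
-- g(π ∘ σ) = g(π) ∘ g(σ), and both maps send block transpositions to block transpositions: f̄ shifts σ(i+1,j+1,k+1)
-- to σ(i,j,k) and sends σ(0,j,k) to σ(j−1,k−1,n), while g sends σ(i,j,k) to σ(n−k,n−j,n−i).  So D_{n+1} acts by
-- automorphisms of the Cayley graph, and V is the union of the f̄-orbits of σ(0,1,3) and σ(0,2,3), exchanged by g.
-- For n ≥ 5 the action on V is free: f̄^a fixes σ(0,1,3) or σ(0,2,3) only when n+1 divides a, and f̄^a g swaps the
-- two orbits.  Transitivity and vertex-transitivity of Γ(V) then come from the words f̄^a g^b.

module Submission where

open import Data.Bool using (Bool; true; false; not)
open import Data.Bool.Properties using (not-involutive)
open import Data.Empty using (⊥-elim)
open import Data.List using (List; []; _∷_; _++_; map; upTo; applyUpTo; length; drop; take; reverse; _∷ʳ_; concatMap)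
open import Data.List.Membership.Propositional using (_∈_; _∉_)
open import Data.List.Membership.Propositional.Properties using (∈-++⁻; ∈-++⁺ˡ; ∈-++⁺ʳ; ∈-map⁻; ∈-map⁺; ∈-upTo⁻; ∈-upTo⁺)
open import Data.List.Membership.Propositional.Properties.WithK using (unique∧set⇒bag)
open import Data.List.Properties using (map-applyUpTo; length-applyUpTo; length-map; map-∘; map-++; ++-assoc; ++-identityʳ; reverse-++; unfold-reverse; applyUpTo-∷ʳ; length-drop; length-take)
open import Data.List.Relation.Binary.BagAndSetEquality using (∼bag⇒↭)
open import Data.List.Relation.Binary.Permutation.Propositional using (_↭_; ↭⇒↭ₛ; ↭-sym)
open import Data.List.Relation.Binary.Permutation.Propositional.Properties using (∈-resp-↭; ↭-length; ++⁺ˡ; shifts)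
import Data.List.Relation.Binary.Permutation.Setoid.Properties as PermutationSetoid
open import Data.List.Relation.Unary.All as All using ()
open import Data.List.Relation.Unary.AllPairs using ([]; _∷_)
open import Data.List.Relation.Unary.Any using (here; there)
open import Data.List.Relation.Unary.Unique.Propositional using (Unique)
open import Data.List.Relation.Unary.Unique.Propositional.Properties using (applyUpTo⁺₁)
open import Data.Nat
open import Data.Nat.DivMod
open import Data.Nat.Properties
open import Data.Nat.Solver using (module +-*-Solver)
open import Data.Product using (Σ; _×_; _,_; proj₁; proj₂)
open import Data.Sum using (_⊎_; inj₁; inj₂)
open import Function.Bundles using (mk⇔)
open import Relation.Binary.PropositionalEquality
open import Relation.Nullary using (yes; no)

open import Defs

open +-*-Solver

at-applyUpTo : ∀ (f : ℕ → ℕ) k i → i < k → at (applyUpTo f k) i ≡ f i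
at-applyUpTo f (suc k) zero p = refl
at-applyUpTo f (suc k) (suc i) (s≤s p) = at-applyUpTo (λ x → f (suc x)) k i p

applyUpTo-cong : ∀ (f g : ℕ → ℕ) k → (∀ i → i < k → f i ≡ g i) → applyUpTo f k ≡ applyUpTo g k
applyUpTo-cong f g zero h = refl
applyUpTo-cong f g (suc k) h =
  cong₂ _∷_ (h 0 (s≤s z≤n)) (applyUpTo-cong (λ x → f (suc x)) (λ x → g (suc x)) k (λ i p → h (suc i) (s≤s p)))

applyUpTo-at : ∀ xs → applyUpTo (at xs) (length xs) ≡ xs
applyUpTo-at [] = refl
applyUpTo-at (x ∷ xs) = cong (x ∷_) (applyUpTo-at xs)

applyUpTo-++ : ∀ (f : ℕ → ℕ) a b → applyUpTo f (a + b) ≡ applyUpTo f a ++ applyUpTo (λ i → f (a + i)) b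
applyUpTo-++ f zero b = refl
applyUpTo-++ f (suc a) b = cong (f 0 ∷_) (applyUpTo-++ (λ x → f (suc x)) a b)

at-map : ∀ (f : ℕ → ℕ) xs i → i < length xs → at (map f xs) i ≡ f (at xs i)
at-map f (x ∷ xs) zero p = refl
at-map f (x ∷ xs) (suc i) (s≤s p) = at-map f xs i p

at-beyond : ∀ xs i → length xs ≤ i → at xs i ≡ 0
at-beyond [] i p = refl
at-beyond (x ∷ xs) (suc i) (s≤s p) = at-beyond xs i p

at-∈ : ∀ xs i → i < length xs → at xs i ∈ xs
at-∈ (x ∷ xs) zero p = here refl
at-∈ (x ∷ xs) (suc i) (s≤s p) = there (at-∈ xs i p)

∈⇒at : ∀ {x} xs → x ∈ xs → Σ ℕ λ i → i < length xs × at xs i ≡ x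
∈⇒at (y ∷ xs) (here refl) = 0 , s≤s z≤n , refl
∈⇒at (y ∷ xs) (there p) with ∈⇒at xs p
... | i , q , e = suc i , s≤s q , e

pos-spec : ∀ {r} xs → r ∈ xs → pos xs r < length xs × at xs (pos xs r) ≡ r
pos-spec {r} (x ∷ xs) m with x ≟ r
... | yes e = s≤s z≤n , e
pos-spec {r} (x ∷ xs) (here e) | no ne = ⊥-elim (ne (sym e))
pos-spec {r} (x ∷ xs) (there m) | no ne with pos-spec xs m
... | a , b = s≤s a , b

pos-++ : ∀ {r} xs ys → r ∉ xs → pos (xs ++ ys) r ≡ length xs + pos ys r
pos-++ [] ys h = refl
pos-++ {r} (x ∷ xs) ys h with x ≟ r
... | yes e = ⊥-elim (h (here (sym e)))
... | no _ = cong suc (pos-++ xs ys (λ m → h (there m)))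

pos-head : ∀ {r} xs → pos (r ∷ xs) r ≡ 0
pos-head {r} xs with r ≟ r
... | yes _ = refl
... | no ne = ⊥-elim (ne refl)

run : ℕ → ℕ → List ℕ
run a m = applyUpTo (λ x → a + x) m

range-run : ∀ a b → range a b ≡ run a (suc b ∸ a)
range-run a b = map-applyUpTo (λ x → x) (a +_) (suc b ∸ a)

range-suc-run : ∀ x m → range (suc x) (x + m) ≡ run (suc x) m
range-suc-run x m = trans (range-run (suc x) (x + m)) (cong (run (suc x)) (m+n∸m≡n x m))

run-suc : ∀ a m → run a (suc m) ≡ a ∷ run (suc a) m
run-suc a m = cong₂ _∷_ (+-identityʳ a) (applyUpTo-cong _ _ m (λ i _ → +-suc a i))

run-++ : ∀ a m k → run a (m + k) ≡ run a m ++ run (a + m) k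
run-++ a m k = trans (applyUpTo-++ (λ x → a + x) m k) (cong (run a m ++_) (applyUpTo-cong _ _ k (λ i _ → sym (+-assoc a m i))))

length-run : ∀ a m → length (run a m) ≡ m
length-run a m = length-applyUpTo _ m

∈-run⁻ : ∀ {x} a m → x ∈ run a m → a ≤ x × x < a + m
∈-run⁻ a (suc m) (here refl) = m≤m+n a 0 , +-monoʳ-< a (s≤s z≤n)
∈-run⁻ {x} a (suc m) (there p) with ∈-run⁻ (suc a) m (subst (x ∈_) (applyUpTo-cong _ _ m (λ i _ → +-suc a i)) p)
... | u , v = ≤-trans (n≤1+n a) u , subst (x <_) (sym (+-suc a m)) v

∈-run⁺ : ∀ {x} a m → a ≤ x → x < a + m → x ∈ run a m
∈-run⁺ {x} a zero p q = ⊥-elim (<-irrefl refl (≤-trans q (≤-trans (≤-reflexive (+-identityʳ a)) p)))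
∈-run⁺ {x} a (suc m) p q with a ≟ x
... | yes refl = subst (x ∈_) (sym (run-suc x m)) (here refl)
... | no ne = subst (x ∈_) (sym (run-suc a m)) (there (∈-run⁺ (suc a) m (≤∧≢⇒< p ne) (subst (x <_) (+-suc a m) q)))

map-run : ∀ (f : ℕ → ℕ) a m d → (∀ x → a ≤ x → x < a + m → f x ≡ x ∸ d) → d ≤ a → map f (run a m) ≡ run (a ∸ d) m
map-run f a m d h dle = trans (map-applyUpTo _ f m) (applyUpTo-cong _ _ m (λ i i<m → trans (h (a + i) (m≤m+n a i) (+-monoʳ-< a i<m)) (+-∸-comm i dle)))

at-drop : ∀ k xs i → at (drop k xs) i ≡ at xs (k + i)
at-drop zero xs i = refl
at-drop (suc k) [] i = refl
at-drop (suc k) (x ∷ xs) i = at-drop k xs i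

at-take : ∀ k xs i → i < k → at (take k xs) i ≡ at xs i
at-take (suc k) [] i p = refl
at-take (suc k) (x ∷ xs) zero p = refl
at-take (suc k) (x ∷ xs) (suc i) (s≤s p) = at-take k xs i p

drop-++-∷ : ∀ (xs : List ℕ) y ys → drop (suc (length xs)) (xs ++ y ∷ ys) ≡ ys
drop-++-∷ [] y ys = refl
drop-++-∷ (x ∷ xs) y ys = drop-++-∷ xs y ys

take-length-++ : ∀ (xs ys : List ℕ) → take (length xs) (xs ++ ys) ≡ xs
take-length-++ [] ys = refl
take-length-++ (x ∷ xs) ys = cong (x ∷_) (take-length-++ xs ys)

run-∷ʳ : ∀ a c → run a (suc c) ≡ run a c ++ (a + c) ∷ []
run-∷ʳ a c = trans (cong (run a) (+-comm 1 c)) (trans (run-++ a c 1) (cong (λ z → run a c ++ z ∷ []) (+-identityʳ (a + c))))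

reverse-at : ∀ xs → reverse xs ≡ applyUpTo (λ i → at xs (length xs ∸ suc i)) (length xs)
reverse-at [] = refl
reverse-at (x ∷ xs) = begin
    reverse (x ∷ xs) ≡⟨ unfold-reverse x xs ⟩
    reverse xs ∷ʳ x ≡⟨ cong (_∷ʳ x) (reverse-at xs) ⟩
    applyUpTo (λ i → at xs (L ∸ suc i)) L ∷ʳ x
      ≡⟨ cong₂ _∷ʳ_ (applyUpTo-cong _ _ L (λ i p → cong (at (x ∷ xs)) (sym (+-∸-assoc 1 p)))) (cong (at (x ∷ xs)) (sym (n∸n≡0 L))) ⟩
    applyUpTo g L ∷ʳ g L ≡⟨ applyUpTo-∷ʳ g L ⟩
    applyUpTo g (suc L) ∎
  where
  open ≡-Reasoning
  L = length xs
  g : ℕ → ℕ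
  g i = at (x ∷ xs) (suc L ∸ suc i)


pairs : {A : Set} → A × A → List A
pairs (a , b) = a ∷ b ∷ []

∈-concatMap-pairs⁻ : {A : Set} {x : A} (ps : List (A × A)) → x ∈ concatMap pairs ps →
                     Σ (A × A) λ p → p ∈ ps × (x ≡ proj₁ p ⊎ x ≡ proj₂ p)
∈-concatMap-pairs⁻ (p ∷ ps) x∈ with ∈-++⁻ (pairs p) x∈
... | inj₁ (here x≡)         = p , here refl , inj₁ x≡
... | inj₁ (there (here x≡)) = p , here refl , inj₂ x≡
... | inj₂ x∈ps with ∈-concatMap-pairs⁻ ps x∈ps
...   | q , q∈ , x≡ = q , there q∈ , x≡

∈-concatMap-pairs⁺ˡ : {A : Set} {a b : A} (ps : List (A × A)) → (a , b) ∈ ps → a ∈ concatMap pairs ps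
∈-concatMap-pairs⁺ˡ (_ ∷ ps) (here refl) = here refl
∈-concatMap-pairs⁺ˡ (p ∷ ps) (there q∈)  = ∈-++⁺ʳ (pairs p) (∈-concatMap-pairs⁺ˡ ps q∈)

∈-concatMap-pairs⁺ʳ : {A : Set} {a b : A} (ps : List (A × A)) → (a , b) ∈ ps → b ∈ concatMap pairs ps
∈-concatMap-pairs⁺ʳ (_ ∷ ps) (here refl) = there (here refl)
∈-concatMap-pairs⁺ʳ (p ∷ ps) (there q∈)  = ∈-++⁺ʳ (pairs p) (∈-concatMap-pairs⁺ʳ ps q∈)


module Residues (m : ℕ) where

  n : ℕ
  n = suc m

  N : ℕ
  N = suc n

  infix 4 _≈_
  _≈_ : ℕ → ℕ → Set
  a ≈ b = a % N ≡ b % N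

  %-absorbˡ : ∀ a b → (a % N + b) % N ≡ (a + b) % N
  %-absorbˡ a b = trans (%-distribˡ-+ (a % N) b N) (trans (cong (λ z → (z + b % N) % N) (m%n%n≡m%n a N)) (sym (%-distribˡ-+ a b N)))

  +-≈ : ∀ {a a' b b'} → a ≈ a' → b ≈ b' → a + b ≈ a' + b'
  +-≈ {a} {a'} {b} {b'} p q = trans (%-distribˡ-+ a b N) (trans (cong₂ (λ x y → (x + y) % N) p q) (sym (%-distribˡ-+ a' b' N)))

  ≡⇒≈ : ∀ {a b} → a ≡ b → a ≈ b
  ≡⇒≈ refl = refl

  %≈ : ∀ a → a % N ≈ a
  %≈ a = m%n%n≡m%n a N

  %-small : ∀ {a} → a ≤ n → a % N ≡ a
  %-small p = m≤n⇒m%n≡m p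

  %≤ : ∀ a → a % N ≤ n
  %≤ a = ≤-pred (m%n<n a N)

  ≈⇒≡ : ∀ a b → a ≤ n → b ≤ n → a ≈ b → a ≡ b
  ≈⇒≡ a b p q e = trans (sym (%-small p)) (trans e (%-small q))

  N≈0 : N ≈ 0
  N≈0 = n%n≡0 N

  *N≈0 : ∀ k → k * N ≈ 0
  *N≈0 k = m*n%n≡0 k N

  neg : ℕ → ℕ
  neg x = (N ∸ x % N) % N

  neg-inverseʳ : ∀ x → x + neg x ≈ 0
  neg-inverseʳ x = trans (+-≈ {x} {x % N} {neg x} {N ∸ x % N} (sym (%≈ x)) (%≈ (N ∸ x % N)))
                    (trans (cong (_% N) (m+[n∸m]≡n (<⇒≤ (m%n<n x N)))) N≈0)

  neg≤ : ∀ x → neg x ≤ n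
  neg≤ x = %≤ (N ∸ x % N)

  +-cancelʳ-≈ : ∀ a b c → a + c ≈ b + c → a ≈ b
  +-cancelʳ-≈ a b c e = begin
    a % N                 ≡⟨ cong (_% N) (sym (+-identityʳ a)) ⟩
    (a + 0) % N           ≡⟨ +-≈ {a} {a} {0} {c + neg c} refl (sym (neg-inverseʳ c)) ⟩
    (a + (c + neg c)) % N ≡⟨ cong (_% N) (sym (+-assoc a c (neg c))) ⟩
    (a + c + neg c) % N   ≡⟨ +-≈ {a + c} {b + c} {neg c} {neg c} e refl ⟩
    (b + c + neg c) % N   ≡⟨ cong (_% N) (+-assoc b c (neg c)) ⟩
    (b + (c + neg c)) % N ≡⟨ +-≈ {b} {b} {c + neg c} {0} refl (neg-inverseʳ c) ⟩
    (b + 0) % N           ≡⟨ cong (_% N) (+-identityʳ b) ⟩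
    b % N ∎
    where open ≡-Reasoning

  N∸N∸ : ∀ {a} → a ≤ N → N ∸ (N ∸ a) ≡ a
  N∸N∸ p = m∸[m∸n]≡n p

  N∸-bnd : ∀ {a} → 1 ≤ a → N ∸ a ≤ n
  N∸-bnd {suc a} _ = m∸n≤m n a

  N∸-pos : ∀ {a} → a ≤ n → 1 ≤ N ∸ a
  N∸-pos {a} p = subst (1 ≤_) (sym (+-∸-assoc 1 p)) (s≤s z≤n)

  N∸-injective : ∀ {a b} → a ≤ N → b ≤ N → N ∸ a ≡ N ∸ b → a ≡ b
  N∸-injective p q e = trans (sym (N∸N∸ p)) (trans (cong (N ∸_) e) (N∸N∸ q))

  neg-inverseˡ : ∀ x → neg x + x ≈ 0
  neg-inverseˡ x = trans (cong (_% N) (+-comm (neg x) x)) (neg-inverseʳ x)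

  neg≡N∸ : ∀ {x} → 1 ≤ x → x ≤ n → neg x ≡ N ∸ x
  neg≡N∸ {x} o p = trans (cong (λ z → (N ∸ z) % N) (%-small p)) (%-small (N∸-bnd o))

  neg-0 : neg 0 ≡ 0
  neg-0 = N≈0

  neg-cong : ∀ {a b} → a ≈ b → neg a ≡ neg b
  neg-cong e = cong (λ z → (N ∸ z) % N) e

  neg-involutive-≈ : ∀ a → neg (neg a) ≈ a
  neg-involutive-≈ a = +-cancelʳ-≈ (neg (neg a)) a (neg a) (trans (neg-inverseˡ (neg a)) (sym (neg-inverseʳ a)))

  neg-involutive : ∀ {a} → a ≤ n → neg (neg a) ≡ a
  neg-involutive {a} p = ≈⇒≡ (neg (neg a)) a (neg≤ (neg a)) p (neg-involutive-≈ a)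

  neg-+-≈ : ∀ a b → neg (a + b) ≈ neg a + neg b
  neg-+-≈ a b = +-cancelʳ-≈ (neg (a + b)) (neg a + neg b) (a + b) (trans (neg-inverseˡ (a + b)) (sym (begin
    (neg a + neg b + (a + b)) % N  ≡⟨ cong (_% N) (solve 4 (λ x y u v → (x :+ y) :+ (u :+ v) := (u :+ x) :+ (v :+ y)) refl (neg a) (neg b) a b) ⟩
    (a + neg a + (b + neg b)) % N  ≡⟨ +-≈ {a + neg a} {0} {b + neg b} {0} (neg-inverseʳ a) (neg-inverseʳ b) ⟩
    0                              ∎)))
    where open ≡-Reasoning


module Permutations (m : ℕ) where

  open Residues m public

  -- Sym n π, restated as: app π = [0 π] is a bijection of {0, …, n} fixing 0.
  record Perm (π : List ℕ) : Set where
    field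
      length≡n : length π ≡ n
      app≤n : ∀ x → x ≤ n → app π x ≤ n
      app>0  : ∀ x → 1 ≤ x → x ≤ n → 1 ≤ app π x
      app-injective : ∀ x y → x ≤ n → y ≤ n → app π x ≡ app π y → x ≡ y
      app-surjective : ∀ y → y ≤ n → Σ ℕ λ x → x ≤ n × app π x ≡ y
  open Perm public

  range1n : range 1 n ≡ run 1 n
  range1n = range-run 1 n

  Unique-resp-↭ : ∀ {xs ys : List ℕ} → xs ↭ ys → Unique xs → Unique ys
  Unique-resp-↭ p u = PermutationSetoid.Unique-resp-↭ (setoid ℕ) (↭⇒↭ₛ p) u

  unique-run : Unique (run 1 n)
  unique-run = applyUpTo⁺₁ _ n (λ i<j _ e → <⇒≢ i<j (suc-injective e))

  Unique⇒at-injective : ∀ xs i j → Unique xs → i < length xs → j < length xs → at xs i ≡ at xs j → i ≡ j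
  Unique⇒at-injective (x ∷ xs) zero zero u p q e = refl
  Unique⇒at-injective (x ∷ xs) zero (suc j) (px ∷ u) p (s≤s q) e = ⊥-elim (All.lookup px (at-∈ xs j q) e)
  Unique⇒at-injective (x ∷ xs) (suc i) zero (px ∷ u) (s≤s p) q e = ⊥-elim (All.lookup px (at-∈ xs i p) (sym e))
  Unique⇒at-injective (x ∷ xs) (suc i) (suc j) (px ∷ u) (s≤s p) (s≤s q) e = cong suc (Unique⇒at-injective xs i j u p q e)

  Sym⇒Perm : ∀ {π} → Sym n π → Perm π
  Sym⇒Perm {π} s = record { length≡n = L ; app≤n = B' ; app>0 = Z ; app-injective = I ; app-surjective = S }
    where
    s' : π ↭ run 1 n
    s' = subst (π ↭_) range1n s
    L : length π ≡ n
    L = trans (↭-length s') (length-run 1 n)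
    el : ∀ {x} → x ∈ π → 1 ≤ x × x ≤ n
    el m with ∈-run⁻ 1 n (∈-resp-↭ s' m)
    ... | a , b = a , ≤-pred b
    B' : ∀ x → x ≤ n → app π x ≤ n
    B' zero _ = z≤n
    B' (suc x) p = proj₂ (el (at-∈ π x (subst (x <_) (sym L) p)))
    Z : ∀ x → 1 ≤ x → x ≤ n → 1 ≤ app π x
    Z (suc x) _ p = proj₁ (el (at-∈ π x (subst (x <_) (sym L) p)))
    U : Unique π
    U = Unique-resp-↭ (↭-sym s') unique-run
    I : ∀ x y → x ≤ n → y ≤ n → app π x ≡ app π y → x ≡ y
    I zero zero _ _ _ = refl
    I zero (suc y) _ q e = ⊥-elim (<⇒≢ (Z (suc y) (s≤s z≤n) q) e)
    I (suc x) zero p _ e = ⊥-elim (<⇒≢ (Z (suc x) (s≤s z≤n) p) (sym e))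
    I (suc x) (suc y) p q e = cong suc (Unique⇒at-injective π x y U (subst (x <_) (sym L) p) (subst (y <_) (sym L) q) e)
    S : ∀ y → y ≤ n → Σ ℕ λ x → x ≤ n × app π x ≡ y
    S zero _ = 0 , z≤n , refl
    S (suc y) p with ∈⇒at π (∈-resp-↭ (↭-sym s') (∈-run⁺ 1 n (s≤s z≤n) (s≤s p)))
    ... | i , i< , e = suc i , subst (i <_) L i< , e

  Perm⇒Sym : ∀ {π} → Perm π → Sym n π
  Perm⇒Sym {π} g = subst (π ↭_) (sym range1n) (∼bag⇒↭ (unique∧set⇒bag U unique-run (λ {x} → mk⇔ (F x) (G x))))
    where
    L = length≡n g
    U0 : Unique (applyUpTo (at π) n)
    U0 = applyUpTo⁺₁ (at π) n (λ {i} {j} i<j j<n e → <⇒≢ i<j (suc-injective (app-injective g (suc i) (suc j) (<-trans i<j j<n) j<n e)))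
    U : Unique π
    U = subst Unique (trans (cong (applyUpTo (at π)) (sym L)) (applyUpTo-at π)) U0
    F : ∀ x → x ∈ π → x ∈ run 1 n
    F x m with ∈⇒at π m
    ... | i , i< , refl = ∈-run⁺ 1 n (app>0 g (suc i) (s≤s z≤n) (subst (i <_) L i<)) (s≤s (app≤n g (suc i) (subst (i <_) L i<)))
    G : ∀ x → x ∈ run 1 n → x ∈ π
    G x m with ∈-run⁻ 1 n m
    ... | a , b with app-surjective g x (≤-pred b)
    ... | zero , _ , e = ⊥-elim (<⇒≢ a e)
    ... | suc i , i≤ , e = subst (_∈ π) e (at-∈ π i (subst (i <_) (sym L) i≤))

  app-tabulate : ∀ (f : ℕ → ℕ) t → 1 ≤ t → t ≤ n → app (map f (range 1 n)) t ≡ f t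
  app-tabulate f (suc i) _ p = trans (cong (λ l → at l i) (trans (cong (map f) range1n) (map-applyUpTo (λ x → 1 + x) f n))) (at-applyUpTo (λ x → f (1 + x)) n i p)

  tabulate-cong : ∀ (f g : ℕ → ℕ) → (∀ t → 1 ≤ t → t ≤ n → f t ≡ g t) → map f (range 1 n) ≡ map g (range 1 n)
  tabulate-cong f g e = begin
      map f (range 1 n)           ≡⟨ cong (map f) range1n ⟩
      map f (run 1 n)               ≡⟨ map-applyUpTo (λ x → 1 + x) f n ⟩
      applyUpTo (λ x → f (1 + x)) n ≡⟨ applyUpTo-cong (λ x → f (1 + x)) (λ x → g (1 + x)) n (λ i p → e (suc i) (s≤s z≤n) p) ⟩
      applyUpTo (λ x → g (1 + x)) n ≡⟨ sym (map-applyUpTo (λ x → 1 + x) g n) ⟩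
      map g (run 1 n)               ≡⟨ cong (map g) (sym range1n) ⟩
      map g (range 1 n) ∎
    where open ≡-Reasoning

  length-tabulate : ∀ (f : ℕ → ℕ) → length (map f (range 1 n)) ≡ n
  length-tabulate f = trans (length-map f (range 1 n)) (trans (cong length range1n) (length-run 1 n))

  tabulate-app : ∀ π → length π ≡ n → map (app π) (range 1 n) ≡ π
  tabulate-app π L = trans (cong (map (app π)) range1n) (trans (map-applyUpTo (λ x → 1 + x) (app π) n) (trans (cong (applyUpTo (at π)) (sym L)) (applyUpTo-at π)))

  app-∘ₚ : ∀ π σ x → app (π ∘ₚ σ) x ≡ app π (app σ x)
  app-∘ₚ π σ zero = refl
  app-∘ₚ π σ (suc x) with x <? length σ
  ... | yes p = at-map (app π) σ x p
  ... | no p = trans (at-beyond (map (app π) σ) x (subst (_≤ x) (sym (length-map (app π) σ)) (≮⇒≥ p)))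
                     (sym (cong (app π) (at-beyond σ x (≮⇒≥ p))))


module ToricMaps (m : ℕ) where

  open Permutations m public

  -- [0 (toric π c q)] is α^c ∘ [0 π] ∘ α^q; it fixes 0, as a [0 ·]-form must, exactly when Normalised π c q.
  -- Every power of f̄ sends π to such a form (fbar^-toric), and the forms compose and reverse like the dihedral group.
  toricAt : List ℕ → ℕ → ℕ → ℕ → ℕ
  toricAt π c q x = (app π ((x + q) % N) + c) % N

  toric : List ℕ → ℕ → ℕ → List ℕ
  toric π c q = map (toricAt π c q) (range 1 n)

  record Normalised (π : List ℕ) (c q : ℕ) : Set where
    constructor normalised
    field normalised≡0 : (app π (q % N) + c) % N ≡ 0
  open Normalised public

  app-toric : ∀ {π c q} → Normalised π c q → ∀ x → x ≤ n → app (toric π c q) x ≡ toricAt π c q x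
  app-toric nm zero _ = sym (normalised≡0 nm)
  app-toric nm (suc x) p = app-tabulate _ (suc x) (s≤s z≤n) p

  toric-cong : ∀ π {c c' q q'} → c ≈ c' → q ≈ q' → toric π c q ≡ toric π c' q'
  toric-cong π {c} {c'} {q} {q'} ec eq = tabulate-cong _ _ λ t _ _ →
    trans (cong (λ z → (app π z + c) % N) (+-≈ {t} {t} {q} {q'} refl eq)) (+-≈ {app π ((t + q') % N)} {app π ((t + q') % N)} {c} {c'} refl ec)

  fbar-toric : ∀ π c q r → Normalised π c q → fbar n r (toric π c q) ≡ toric π (c + (N ∸ r)) (q + pos (0 ∷ toric π c q) r)
  fbar-toric π c q r nm = tabulate-cong _ _ λ t _ _ → let p = pos (0 ∷ toric π c q) r in begin
      (app (toric π c q) ((t + p) % N) + (N ∸ r)) % N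
        ≡⟨ cong (λ z → (z + (N ∸ r)) % N) (app-toric nm ((t + p) % N) (%≤ (t + p))) ⟩
      ((app π (((t + p) % N + q) % N) + c) % N + (N ∸ r)) % N
        ≡⟨ cong (λ z → ((app π z + c) % N + (N ∸ r)) % N) (trans (%-absorbˡ (t + p) q) (cong (_% N) (trans (+-assoc t p q) (cong (t +_) (+-comm p q))))) ⟩
      ((app π ((t + (q + p)) % N) + c) % N + (N ∸ r)) % N
        ≡⟨ %-absorbˡ (app π ((t + (q + p)) % N) + c) (N ∸ r) ⟩
      (app π ((t + (q + p)) % N) + c + (N ∸ r)) % N
        ≡⟨ cong (_% N) (+-assoc (app π ((t + (q + p)) % N)) c (N ∸ r)) ⟩
      (app π ((t + (q + p)) % N) + (c + (N ∸ r))) % N ∎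
    where open ≡-Reasoning

  toricAt-injective : ∀ {π c q} → Perm π → ∀ x y → x ≤ n → y ≤ n → toricAt π c q x ≡ toricAt π c q y → x ≡ y
  toricAt-injective {π} {c} {q} g x y p p' e =
    ≈⇒≡ x y p p' (+-cancelʳ-≈ x y q (app-injective g _ _ (%≤ (x + q)) (%≤ (y + q))
      (≈⇒≡ (app π ((x + q) % N)) (app π ((y + q) % N)) (app≤n g _ (%≤ (x + q))) (app≤n g _ (%≤ (y + q))) (+-cancelʳ-≈ (app π ((x + q) % N)) (app π ((y + q) % N)) c e))))

  toric-perm : ∀ {π c q} → Perm π → Normalised π c q → Perm (toric π c q)
  toric-perm {π} {c} {q} g nm = record { length≡n = length-tabulate _ ; app≤n = B' ; app>0 = Z ; app-injective = I ; app-surjective = S }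
    where
    B' : ∀ x → x ≤ n → app (toric π c q) x ≤ n
    B' x p = subst (_≤ n) (sym (app-toric nm x p)) (%≤ (app π ((x + q) % N) + c))
    Z : ∀ x → 1 ≤ x → x ≤ n → 1 ≤ app (toric π c q) x
    Z x o p with app (toric π c q) x in eq
    ... | suc _ = s≤s z≤n
    ... | zero = ⊥-elim (<⇒≢ o (sym (toricAt-injective {π} {c} {q} g x 0 p z≤n (trans (sym (app-toric nm x p)) (trans eq (sym (normalised≡0 nm)))))))
    I : ∀ x y → x ≤ n → y ≤ n → app (toric π c q) x ≡ app (toric π c q) y → x ≡ y
    I x y p p' e = toricAt-injective {π} {c} {q} g x y p p' (trans (sym (app-toric nm x p)) (trans e (app-toric nm y p')))
    S : ∀ y → y ≤ n → Σ ℕ λ x → x ≤ n × app (toric π c q) x ≡ y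
    S y p with app-surjective g ((y + neg c) % N) (%≤ (y + neg c))
    ... | w , w≤ , ew = (w + neg q) % N , %≤ (w + neg q) , trans (app-toric nm ((w + neg q) % N) (%≤ (w + neg q))) (begin
        (app π (((w + neg q) % N + q) % N) + c) % N
          ≡⟨ cong (λ z → (app π z + c) % N) (trans (%-absorbˡ (w + neg q) q) (trans (cong (_% N) (+-assoc w (neg q) q))
               (trans (+-≈ {w} {w} {neg q + q} {0} refl (trans (cong (_% N) (+-comm (neg q) q)) (neg-inverseʳ q)))
               (trans (cong (_% N) (+-identityʳ w)) (%-small w≤))))) ⟩
        (app π w + c) % N ≡⟨ cong (λ z → (z + c) % N) ew ⟩
        ((y + neg c) % N + c) % N ≡⟨ %-absorbˡ (y + neg c) c ⟩
        (y + neg c + c) % N ≡⟨ cong (_% N) (+-assoc y (neg c) c) ⟩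
        (y + (neg c + c)) % N ≡⟨ +-≈ {y} {y} {neg c + c} {0} refl (trans (cong (_% N) (+-comm (neg c) c)) (neg-inverseʳ c)) ⟩
        (y + 0) % N ≡⟨ cong (_% N) (+-identityʳ y) ⟩
        y % N ≡⟨ %-small p ⟩
        y ∎)
      where open ≡-Reasoning

  toric-unique : ∀ {π c q c' q'} → Perm π → Normalised π c q → Normalised π c' q' → c ≈ c' → toric π c q ≡ toric π c' q'
  toric-unique {π} {c} {q} {c'} {q'} g nm nm' ec = toric-cong π ec e3
    where
    e1 : app π (q % N) + c ≈ app π (q' % N) + c
    e1 = trans (normalised≡0 nm) (trans (sym (normalised≡0 nm')) (+-≈ {app π (q' % N)} {app π (q' % N)} {c'} {c} refl (sym ec)))
    e2 : app π (q % N) ≡ app π (q' % N)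
    e2 = ≈⇒≡ (app π (q % N)) (app π (q' % N)) (app≤n g _ (%≤ q)) (app≤n g _ (%≤ q')) (+-cancelʳ-≈ (app π (q % N)) (app π (q' % N)) c e1)
    e3 : q % N ≡ q' % N
    e3 = app-injective g _ _ (%≤ q) (%≤ q') e2

  toric-id : ∀ {π} → Perm π → toric π 0 0 ≡ π
  toric-id {π} g = trans (tabulate-cong _ _ λ t _ p → trans (cong (λ z → (app π (z % N) + 0) % N) (+-identityʳ t))
                       (trans (cong (λ z → (app π z + 0) % N) (%-small p)) (trans (cong (_% N) (+-identityʳ (app π t))) (%-small (app≤n g t p)))))
               (tabulate-app π (length≡n g))

  normalised-id : ∀ π → Normalised π 0 0
  normalised-id π = normalised refl

  pos-perm : ∀ {ρ} → Perm ρ → ∀ r → r ≤ n → pos (0 ∷ ρ) r ≤ n × app ρ (pos (0 ∷ ρ) r) ≡ r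
  pos-perm {ρ} g r p with app-surjective g r p
  ... | x , x≤ , e with pos-spec (0 ∷ ρ) (subst (_∈ 0 ∷ ρ) e (at-∈ (0 ∷ ρ) x (s≤s (subst (x ≤_) (sym (length≡n g)) x≤))))
  ... | a , b = ≤-pred (subst (pos (0 ∷ ρ) r <_) (cong suc (length≡n g)) a) , b

  fbar^ : ℕ → List ℕ → List ℕ
  fbar^ zero π = π
  fbar^ (suc k) π = fbar n 1 (fbar^ k π)

  ToricPower : List ℕ → ℕ → Set
  ToricPower π k = Σ ℕ λ q → fbar^ k π ≡ toric π (k * n) q × Normalised π (k * n) q

  fbar^-toric : ∀ {π} → Perm π → ∀ k → ToricPower π k
  fbar^-toric {π} g zero = 0 , sym (toric-id g) , normalised-id π
  fbar^-toric {π} g (suc k) with fbar^-toric g k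
  ... | q , e , nm = q + p , eq , normalised nmp
    where
    ρ = toric π (k * n) q
    gρ = toric-perm g nm
    p = pos (0 ∷ ρ) 1
    pp = pos-perm gρ 1 (s≤s z≤n)
    eq : fbar^ (suc k) π ≡ toric π (n + k * n) (q + p)
    eq = trans (cong (fbar n 1) e) (trans (fbar-toric π (k * n) q 1 nm) (toric-cong π (≡⇒≈ (+-comm (k * n) n)) refl))
    A = app π ((p + q) % N)
    H : (A + k * n) % N ≡ 1
    H = trans (sym (app-toric nm p (proj₁ pp))) (proj₂ pp)
    nmp : (app π ((q + p) % N) + (n + k * n)) % N ≡ 0
    nmp = begin
      (app π ((q + p) % N) + (n + k * n)) % N ≡⟨ cong (λ z → (app π (z % N) + (n + k * n)) % N) (+-comm q p) ⟩
      (A + (n + k * n)) % N ≡⟨ cong (_% N) (trans (cong (A +_) (+-comm n (k * n))) (sym (+-assoc A (k * n) n))) ⟩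
      (A + k * n + n) % N ≡⟨ sym (%-absorbˡ (A + k * n) n) ⟩
      ((A + k * n) % N + n) % N ≡⟨ cong (λ z → (z + n) % N) H ⟩
      N % N ≡⟨ N≈0 ⟩
      0 ∎
      where open ≡-Reasoning

  fbar^-N : ∀ {π} → Perm π → fbar^ N π ≡ π
  fbar^-N {π} g = go (fbar^-toric g N)
    where
    c0 : N * n ≈ 0
    c0 = trans (cong (_% N) (*-comm N n)) (*N≈0 n)
    go : ToricPower π N → fbar^ N π ≡ π
    go (q , e , nm) = trans e (trans (toric-unique g nm (normalised-id π) c0) (toric-id g))

  fbar^-+ : ∀ a b π → fbar^ (a + b) π ≡ fbar^ a (fbar^ b π)
  fbar^-+ zero b π = refl
  fbar^-+ (suc a) b π = cong (fbar n 1) (fbar^-+ a b π)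

  fbar^-perm : ∀ {π} → Perm π → ∀ k → Perm (fbar^ k π)
  fbar^-perm {π} g k = go (fbar^-toric g k)
    where
    go : ToricPower π k → Perm (fbar^ k π)
    go (q , e , nm) = subst Perm (sym e) (toric-perm g nm)

  fbar^-*N : ∀ {π} → Perm π → ∀ a → fbar^ (a * N) π ≡ π
  fbar^-*N {π} g zero = refl
  fbar^-*N {π} g (suc a) = trans (fbar^-+ N (a * N) π) (trans (cong (fbar^ N) (fbar^-*N g a)) (fbar^-N g))

  fbar^-%N : ∀ {π} → Perm π → ∀ a → fbar^ a π ≡ fbar^ (a % N) π
  fbar^-%N {π} g a = trans (cong (λ z → fbar^ z π) (m≡m%n+[m/n]*n a N))
    (trans (fbar^-+ (a % N) ((a / N) * N) π) (cong (fbar^ (a % N)) (fbar^-*N g (a / N))))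

  fbar^-k*n+k : ∀ {π} → Perm π → ∀ k → fbar^ (k * n + k) π ≡ π
  fbar^-k*n+k {π} g k = trans (cong (λ z → fbar^ z π) (trans (+-comm (k * n) k) (sym (*-suc k n)))) (fbar^-*N g k)

  fbar^-k+k*n : ∀ {π} → Perm π → ∀ k → fbar^ (k + k * n) π ≡ π
  fbar^-k+k*n {π} g k = trans (cong (λ z → fbar^ z π) (+-comm k (k * n))) (fbar^-k*n+k g k)

  fbar^-sucʳ : ∀ k x → fbar^ (suc k) x ≡ fbar^ k (fbar n 1 x)
  fbar^-sucʳ k x = trans (cong (λ z → fbar^ z x) (+-comm 1 k)) (fbar^-+ k 1 x)

  fbar^-complement : ∀ {x r} l → Perm x → l ≤ N → fbar^ l x ≡ r → x ≡ fbar^ (N ∸ l) r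
  fbar^-complement {x} {r} l g l≤ e = sym (trans (cong (fbar^ (N ∸ l)) (sym e)) (trans (sym (fbar^-+ (N ∸ l) l x)) (trans (cong (λ z → fbar^ z x) (m∸n+n≡m l≤)) (fbar^-N g))))

  fbar^-cancel : ∀ {x} k → Perm x → fbar^ (k * n) (fbar^ k x) ≡ x
  fbar^-cancel {x} k g = trans (sym (fbar^-+ (k * n) k x)) (fbar^-k*n+k g k)

  fbar^-cancelˡ : ∀ k {x y} → Perm x → Perm y → fbar^ k x ≡ fbar^ k y → x ≡ y
  fbar^-cancelˡ k {x} {y} px py e = trans (sym (fbar^-cancel k px)) (trans (cong (fbar^ (k * n)) e) (fbar^-cancel k py))

  fbar^-comm : ∀ a b x → fbar^ a (fbar^ b x) ≡ fbar^ b (fbar^ a x)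
  fbar^-comm a b x = trans (sym (fbar^-+ a b x)) (trans (cong (λ z → fbar^ z x) (+-comm a b)) (fbar^-+ b a x))

  fbar^-within : ∀ {x} → Perm x → ∀ k k' → fbar^ (k' + k * n) (fbar^ k x) ≡ fbar^ k' x
  fbar^-within {x} px k k' = trans (fbar^-+ k' (k * n) (fbar^ k x)) (cong (fbar^ k') (fbar^-cancel k px))

  fbar≡fbar^ : ∀ {π} → Perm π → ∀ r → r ≤ n → fbar n r π ≡ fbar^ r π
  fbar≡fbar^ {π} g r r≤ = go (fbar^-toric g r)
    where
    pp = pos-perm g r r≤
    p = pos (0 ∷ π) r
    r≤N : r ≤ N
    r≤N = ≤-trans r≤ (n≤1+n n)
    nm1 : Normalised π (N ∸ r) p
    nm1 = normalised (trans (cong (λ z → (app π z + (N ∸ r)) % N) (%-small (proj₁ pp)))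
               (trans (cong (λ z → (z + (N ∸ r)) % N) (proj₂ pp)) (trans (cong (_% N) (m+[n∸m]≡n r≤N)) N≈0)))
    c≈ : N ∸ r ≈ r * n
    c≈ = +-cancelʳ-≈ (N ∸ r) (r * n) r (trans (cong (_% N) (m∸n+n≡m r≤N)) (trans N≈0
           (sym (trans (cong (_% N) (trans (+-comm (r * n) r) (sym (*-suc r n)))) (*N≈0 r)))))
    go : ToricPower π r → fbar n r π ≡ fbar^ r π
    go (q , e , nm) = trans (toric-unique g nm1 nm c≈) (sym e)

  N∸-range : ∀ {y} → 1 ≤ y → y ≤ n → 1 ≤ N ∸ y × N ∸ y ≤ n
  N∸-range {suc y} _ p = m<n⇒0<n∸m p , m∸n≤m n y

  app-grev : ∀ π y → 1 ≤ y → y ≤ n → app (grev n π) y ≡ N ∸ app π (N ∸ y)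
  app-grev π y o p = app-tabulate (λ t → N ∸ app π (N ∸ t)) y o p

  grev-perm : ∀ {π} → Perm π → Perm (grev n π)
  grev-perm {π} g = record { length≡n = length-tabulate _ ; app≤n = B' ; app>0 = Z ; app-injective = I ; app-surjective = S }
    where
    B' : ∀ x → x ≤ n → app (grev n π) x ≤ n
    B' zero _ = z≤n
    B' (suc x) p = subst (_≤ n) (sym (app-grev π (suc x) (s≤s z≤n) p))
                     (N∸-bnd (app>0 g _ (proj₁ (N∸-range (s≤s z≤n) p)) (proj₂ (N∸-range (s≤s z≤n) p))))
    Z : ∀ x → 1 ≤ x → x ≤ n → 1 ≤ app (grev n π) x
    Z x o p = subst (1 ≤_) (sym (app-grev π x o p)) (N∸-pos (app≤n g _ (proj₂ (N∸-range o p))))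
    I : ∀ x y → x ≤ n → y ≤ n → app (grev n π) x ≡ app (grev n π) y → x ≡ y
    I zero zero _ _ _ = refl
    I zero (suc y) _ q e = ⊥-elim (<⇒≢ (Z (suc y) (s≤s z≤n) q) e)
    I (suc x) zero p _ e = ⊥-elim (<⇒≢ (Z (suc x) (s≤s z≤n) p) (sym e))
    I (suc x) (suc y) p q e =
      N∸-injective (≤-trans p (n≤1+n n)) (≤-trans q (n≤1+n n))
        (app-injective g _ _ (proj₂ (N∸-range (s≤s z≤n) p)) (proj₂ (N∸-range (s≤s z≤n) q))
          (N∸-injective (≤-trans (app≤n g _ (proj₂ (N∸-range (s≤s z≤n) p))) (n≤1+n n)) (≤-trans (app≤n g _ (proj₂ (N∸-range (s≤s z≤n) q))) (n≤1+n n))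
            (trans (sym (app-grev π (suc x) (s≤s z≤n) p)) (trans e (app-grev π (suc y) (s≤s z≤n) q)))))
    S : ∀ y → y ≤ n → Σ ℕ λ x → x ≤ n × app (grev n π) x ≡ y
    S zero _ = 0 , z≤n , refl
    S (suc y) p with app-surjective g (N ∸ suc y) (proj₂ (N∸-range (s≤s z≤n) p))
    ... | zero , _ , e = ⊥-elim (<⇒≢ (proj₁ (N∸-range (s≤s z≤n) p)) e)
    ... | suc z , z≤ , e = N ∸ suc z , proj₂ (N∸-range (s≤s z≤n) z≤) ,
          trans (app-grev π (N ∸ suc z) (proj₁ (N∸-range (s≤s z≤n) z≤)) (proj₂ (N∸-range (s≤s z≤n) z≤)))
            (trans (cong (λ w → N ∸ app π w) (N∸N∸ (≤-trans z≤ (n≤1+n n))))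
              (trans (cong (N ∸_) e) (N∸N∸ (≤-trans p (n≤1+n n)))))

  grev-involutive : ∀ {π} → Perm π → grev n (grev n π) ≡ π
  grev-involutive {π} g = trans (tabulate-cong _ _ λ t o p →
      trans (cong (N ∸_) (app-grev π (N ∸ t) (proj₁ (N∸-range o p)) (proj₂ (N∸-range o p))))
        (trans (cong (λ w → N ∸ (N ∸ app π w)) (N∸N∸ (≤-trans p (n≤1+n n))))
          (N∸N∸ (≤-trans (app≤n g t p) (n≤1+n n)))))
    (tabulate-app π (length≡n g))

  app-grev-neg : ∀ {π} → Perm π → ∀ y → y ≤ n → app (grev n π) y ≡ neg (app π (neg y))
  app-grev-neg {π} g zero _ = sym (trans (cong (λ z → neg (app π z)) neg-0) neg-0)
  app-grev-neg {π} g (suc y) p =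
    trans (app-grev π (suc y) (s≤s z≤n) p)
      (trans (sym (neg≡N∸ (app>0 g _ (proj₁ (N∸-range (s≤s z≤n) p)) (proj₂ (N∸-range (s≤s z≤n) p))) (app≤n g _ (proj₂ (N∸-range (s≤s z≤n) p)))))
        (cong (λ z → neg (app π z)) (sym (neg≡N∸ (s≤s z≤n) p))))

  neg-shift : ∀ t q → (neg t + q) % N ≡ neg ((t + neg q) % N)
  neg-shift t q = begin
    (neg t + q) % N              ≡⟨ +-≈ {neg t} {neg t} {q} {neg (neg q)} refl (sym (neg-involutive-≈ q)) ⟩
    (neg t + neg (neg q)) % N    ≡⟨ sym (neg-+-≈ t (neg q)) ⟩
    neg (t + neg q) % N          ≡⟨ %-small (neg≤ (t + neg q)) ⟩
    neg (t + neg q)              ≡⟨ neg-cong {t + neg q} {(t + neg q) % N} (sym (%≈ (t + neg q))) ⟩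
    neg ((t + neg q) % N)        ∎
    where open ≡-Reasoning

  grev-toric : ∀ {π c q} → Perm π → Normalised π c q → grev n (toric π c q) ≡ toric (grev n π) (neg c) (neg q)
  grev-toric {π} {c} {q} g nm = tabulate-cong _ _ λ t o p → let A = app π ((neg t + q) % N) ; z = (t + neg q) % N in begin
    N ∸ app (toric π c q) (N ∸ t)       ≡⟨ sym (app-grev (toric π c q) t o p) ⟩
    app (grev n (toric π c q)) t        ≡⟨ app-grev-neg (toric-perm g nm) t p ⟩
    neg (app (toric π c q) (neg t))     ≡⟨ neg-cong {app (toric π c q) (neg t)} {A + c} (trans (cong (_% N) (app-toric nm (neg t) (neg≤ t))) (%≈ (A + c))) ⟩
    neg (A + c)                         ≡⟨ sym (%-small (neg≤ (A + c))) ⟩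
    neg (A + c) % N                     ≡⟨ neg-+-≈ A c ⟩
    (neg A + neg c) % N                 ≡⟨ cong (λ w → (neg (app π w) + neg c) % N) (neg-shift t q) ⟩
    (neg (app π (neg z)) + neg c) % N   ≡⟨ cong (λ w → (w + neg c) % N) (sym (app-grev-neg g z (%≤ (t + neg q)))) ⟩
    (app (grev n π) z + neg c) % N      ∎
    where open ≡-Reasoning

  normalised-fbar : ∀ {π} → Perm π → Normalised π n (pos (0 ∷ π) 1)
  normalised-fbar {π} g = normalised (trans (cong (λ z → (app π z + n) % N) (%-small (proj₁ pp)))
                     (trans (cong (λ z → (z + n) % N) (proj₂ pp)) N≈0))
    where pp = pos-perm g 1 (s≤s z≤n)

  grev-fbar : ∀ {π} → Perm π → grev n (fbar n 1 π) ≡ fbar^ n (grev n π)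
  grev-fbar {π} g = go (fbar^-toric (grev-perm g) n)
    where
    pp = pos-perm g 1 (s≤s z≤n)
    p = pos (0 ∷ π) 1
    e1 : app (grev n π) (neg p % N) ≡ neg (app π p)
    e1 = trans (cong (app (grev n π)) (%-small (neg≤ p)))
          (trans (app-grev-neg g (neg p) (neg≤ p)) (cong (λ w → neg (app π w)) (neg-involutive (proj₁ pp))))
    e2 : app (grev n π) (neg p % N) ≡ neg 1
    e2 = trans e1 (cong neg (proj₂ pp))
    nmG : Normalised (grev n π) (neg n) (neg p)
    nmG = normalised (trans (cong (λ w → (w + neg n) % N) e2)
            (trans (sym (neg-+-≈ 1 n)) (cong (_% N) (trans (neg-cong {N} {0} N≈0) neg-0))))
    c≈ : neg n ≈ n * n
    c≈ = +-cancelʳ-≈ (neg n) (n * n) n (trans (neg-inverseˡ n)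
           (sym (trans (cong (_% N) (trans (+-comm (n * n) n) (sym (*-suc n n)))) (*N≈0 n))))
    go : ToricPower (grev n π) n → grev n (fbar n 1 π) ≡ fbar^ n (grev n π)
    go (q' , e' , nm') = trans (grev-toric g (normalised-fbar g)) (trans (toric-unique (grev-perm g) nmG nm' c≈) (sym e'))

  grev-fbar^ : ∀ {π} → Perm π → ∀ k → grev n (fbar^ k π) ≡ fbar^ (k * n) (grev n π)
  grev-fbar^ {π} g zero = refl
  grev-fbar^ {π} g (suc k) = trans (grev-fbar (fbar^-perm g k)) (trans (cong (fbar^ n) (grev-fbar^ g k)) (sym (fbar^-+ n (k * n) (grev n π))))

  fbar-∘ₚ : ∀ {π σ} → Perm π → Perm σ → Perm (π ∘ₚ σ) → fbar n 1 (π ∘ₚ σ) ≡ fbar n 1 π ∘ₚ fbar^ (pos (0 ∷ π) 1) σ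
  fbar-∘ₚ {π} {σ} gπ pσ gρ = go (fbar^-toric pσ p)
    where
    ρ = π ∘ₚ σ
    p = pos (0 ∷ π) 1
    pp = pos-perm gπ 1 (s≤s z≤n)
    go : ToricPower σ p → fbar n 1 ρ ≡ fbar n 1 π ∘ₚ fbar^ p σ
    go (q₁ , e₁ , N₁) = trans (toric-unique gρ (normalised-fbar gρ) nmρ refl) (sym rhs)
      where
      open ≡-Reasoning
      eσ : app σ (q₁ % N) ≡ p
      eσ = ≈⇒≡ (app σ (q₁ % N)) p (app≤n pσ _ (%≤ q₁)) (proj₁ pp)
             (+-cancelʳ-≈ (app σ (q₁ % N)) p (p * n) (trans (normalised≡0 N₁)
               (sym (trans (cong (_% N) (sym (*-suc p n))) (*N≈0 p)))))
      nmρ : Normalised ρ n q₁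
      nmρ = normalised (trans (cong (λ z → (z + n) % N) (trans (app-∘ₚ π σ (q₁ % N)) (trans (cong (app π) eσ) (proj₂ pp)))) N≈0)
      pt : ∀ t → 1 ≤ t → t ≤ n → app (fbar n 1 π) (toricAt σ (p * n) q₁ t) ≡ toricAt ρ n q₁ t
      pt t _ _ = let s = app σ ((t + q₁) % N) in begin
        app (fbar n 1 π) (toricAt σ (p * n) q₁ t) ≡⟨ app-toric (normalised-fbar gπ) _ (%≤ (s + p * n)) ⟩
        (app π ((toricAt σ (p * n) q₁ t + p) % N) + n) % N
          ≡⟨ cong (λ z → (app π z + n) % N) (begin
               ((s + p * n) % N + p) % N ≡⟨ %-absorbˡ (s + p * n) p ⟩
               (s + p * n + p) % N ≡⟨ cong (_% N) (trans (+-assoc s (p * n) p) (cong (s +_) (trans (+-comm (p * n) p) (sym (*-suc p n))))) ⟩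
               (s + p * N) % N ≡⟨ [m+kn]%n≡m%n s p N ⟩
               s % N ≡⟨ %-small (app≤n pσ _ (%≤ (t + q₁))) ⟩
               s ∎) ⟩
        (app π s + n) % N ≡⟨ cong (λ z → (z + n) % N) (sym (app-∘ₚ π σ ((t + q₁) % N))) ⟩
        toricAt ρ n q₁ t ∎
      rhs : fbar n 1 π ∘ₚ fbar^ p σ ≡ toric ρ n q₁
      rhs = trans (cong (map (app (fbar n 1 π))) e₁)
              (trans (sym (map-∘ (range 1 n))) (tabulate-cong _ _ pt))

  grev-∘ₚ : ∀ {π σ} → Perm π → Perm σ → grev n (π ∘ₚ σ) ≡ grev n π ∘ₚ grev n σ
  grev-∘ₚ {π} {σ} gπ pσ = sym (trans (sym (map-∘ (range 1 n))) (tabulate-cong _ _ pt))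
    where
    pt : ∀ t → 1 ≤ t → t ≤ n → app (grev n π) (N ∸ app σ (N ∸ t)) ≡ N ∸ app (π ∘ₚ σ) (N ∸ t)
    pt t o p = let u = N∸-range o p ; a = app σ (N ∸ t) ; a1 = app>0 pσ _ (proj₁ u) (proj₂ u) ; a2 = app≤n pσ _ (proj₂ u) in
      trans (app-grev π (N ∸ a) (N∸-pos a2) (N∸-bnd a1))
        (trans (cong (λ w → N ∸ app π w) (N∸N∸ (≤-trans a2 (n≤1+n n)))) (cong (N ∸_) (sym (app-∘ₚ π σ (N ∸ t)))))


module BlockTranspositions (m : ℕ) where

  open ToricMaps m public

  -- σ⁺ i a b = σ(i, i+a+1, i+a+b+2) swaps the adjacent blocks of lengths a+1 and b+1 that follow position i;
  -- Fits i a b c says the remaining tail has length c.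
  σ⁺ : ℕ → ℕ → ℕ → List ℕ
  σ⁺ i a b = σ n i (i + suc a) (i + suc a + suc b)

  Fits : ℕ → ℕ → ℕ → ℕ → Set
  Fits i a b c = i + suc a + suc b + c ≡ n

  tabulate-shift : ∀ xs p → length xs ≡ N → p ≤ n → map (λ t → at xs ((t + p) % N)) (range 1 n) ≡ drop (suc p) xs ++ take p xs
  tabulate-shift xs p L p≤ = begin
      map f (range 1 n) ≡⟨ cong (map f) range1n ⟩
      map f (run 1 n) ≡⟨ map-applyUpTo (λ x → 1 + x) f n ⟩
      applyUpTo g n ≡⟨ cong (applyUpTo g) (sym (m∸n+n≡m p≤)) ⟩
      applyUpTo g ((n ∸ p) + p) ≡⟨ applyUpTo-++ g (n ∸ p) p ⟩
      applyUpTo g (n ∸ p) ++ applyUpTo (λ i → g ((n ∸ p) + i)) p ≡⟨ cong₂ _++_ P1 P2 ⟩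
      drop (suc p) xs ++ take p xs ∎
    where
    open ≡-Reasoning
    f : ℕ → ℕ
    f t = at xs ((t + p) % N)
    g : ℕ → ℕ
    g x = f (1 + x)
    P1 : applyUpTo g (n ∸ p) ≡ drop (suc p) xs
    P1 = trans (applyUpTo-cong g (at (drop (suc p) xs)) (n ∸ p) (λ i i< →
            trans (cong (at xs) (trans (%-small (subst (suc (i + p) ≤_) (m∸n+n≡m p≤) (+-monoˡ-< p i<))) (cong suc (+-comm i p))))
                  (sym (at-drop (suc p) xs i))))
          (trans (cong (applyUpTo (at (drop (suc p) xs))) (sym (trans (length-drop (suc p) xs) (cong (_∸ suc p) L))))
                 (applyUpTo-at (drop (suc p) xs)))
    P2 : applyUpTo (λ i → g ((n ∸ p) + i)) p ≡ take p xs
    P2 = trans (applyUpTo-cong _ (at (take p xs)) p (λ i i< →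
            trans (cong (at xs) (trans (cong (_% N) (e i)) (trans ([m+n]%n≡m%n i N) (%-small (≤-trans (<⇒≤ i<) p≤)))))
                  (sym (at-take p xs i i<))))
          (trans (cong (applyUpTo (at (take p xs))) (sym (trans (length-take p xs) (trans (cong (p ⊓_) L) (m≤n⇒m⊓n≡m (≤-trans p≤ (n≤1+n n)))))))
                 (applyUpTo-at (take p xs)))
      where
      e : ∀ i → suc ((n ∸ p) + i) + p ≡ i + N
      e i = trans (cong suc (trans (+-assoc (n ∸ p) i p) (trans (cong ((n ∸ p) +_) (+-comm i p)) (trans (sym (+-assoc (n ∸ p) p i)) (trans (cong (_+ i) (m∸n+n≡m p≤)) (+-comm n i)))))) (sym (+-suc i n))

  α⁻¹ : ℕ → ℕ
  α⁻¹ y = (y + n) % N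

  fbar≡rotation : ∀ π p → pos (0 ∷ π) 1 ≡ p → length π ≡ n → p ≤ n → fbar n 1 π ≡ map α⁻¹ (drop (suc p) (0 ∷ π) ++ take p (0 ∷ π))
  fbar≡rotation π p ep L p≤ = begin
      fbar n 1 π ≡⟨ cong (λ z → map (λ t → α⁻¹ (at (0 ∷ π) ((t + z) % N))) (range 1 n)) ep ⟩
      map (λ t → α⁻¹ (at (0 ∷ π) ((t + p) % N))) (range 1 n) ≡⟨ map-∘ (range 1 n) ⟩
      map α⁻¹ (map (λ t → at (0 ∷ π) ((t + p) % N)) (range 1 n)) ≡⟨ cong (map α⁻¹) (tabulate-shift (0 ∷ π) p (cong suc L) p≤) ⟩
      map α⁻¹ (drop (suc p) (0 ∷ π) ++ take p (0 ∷ π)) ∎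
    where open ≡-Reasoning

  α⁻¹-pos : ∀ {x} → 1 ≤ x → x ≤ n → α⁻¹ x ≡ x ∸ 1
  α⁻¹-pos {suc y} _ p = trans (cong (_% N) (sym (+-suc y n))) (trans ([m+n]%n≡m%n y N) (%-small (≤-trans (n≤1+n y) p)))

  α⁻¹-0 : α⁻¹ 0 ≡ n
  α⁻¹-0 = %-small ≤-refl

  map-α⁻¹-run : ∀ a k → 1 ≤ a → a + k ≤ N → map α⁻¹ (run a k) ≡ run (a ∸ 1) k
  map-α⁻¹-run a k o b = map-run α⁻¹ a k 1 (λ x a≤ x< → α⁻¹-pos (≤-trans o a≤) (≤-pred (≤-trans x< b))) o

  +≡⇒≤ : ∀ x y z → x + y ≡ z → x ≤ z
  +≡⇒≤ x y z e = subst (x ≤_) e (m≤m+n x y)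

  runs : ℕ → ℕ → ℕ → ℕ → List ℕ
  runs i a b c = run 1 i ++ run (suc (i + suc a)) (suc b) ++ run (suc i) (suc a) ++ run (suc (i + suc a + suc b)) c

  σ≡runs : ∀ i a b c → Fits i a b c → σ⁺ i a b ≡ runs i a b c
  σ≡runs i a b c e = cong₂ _++_ (range-run 1 i) (cong₂ _++_ (range-suc-run (i + suc a) (suc b)) (cong₂ _++_ (range-suc-run i (suc a))
                    (trans (cong (range (suc (i + suc a + suc b))) (sym e)) (range-suc-run (i + suc a + suc b) c))))

  σ-Sym : ∀ i a b c → Fits i a b c → Sym n (σ⁺ i a b)
  σ-Sym i a b c e = subst (_↭ range 1 n) (sym (σ≡runs i a b c e))
     (subst (LL ↭_) (sym (trans range1n (cong (run 1) (sym e))))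
       (subst (LL ↭_) (sym Rsplit) (++⁺ˡ (run 1 i) (shifts (run (suc (i + suc a)) (suc b)) (run (suc i) (suc a))))))
    where
    LL = run 1 i ++ run (suc (i + suc a)) (suc b) ++ run (suc i) (suc a) ++ run (suc (i + suc a + suc b)) c
    Rsplit : run 1 (i + suc a + suc b + c) ≡ run 1 i ++ run (suc i) (suc a) ++ run (suc (i + suc a)) (suc b) ++ run (suc (i + suc a + suc b)) c
    Rsplit = begin
       run 1 (i + suc a + suc b + c) ≡⟨ run-++ 1 (i + suc a + suc b) c ⟩
       run 1 (i + suc a + suc b) ++ run (suc (i + suc a + suc b)) c ≡⟨ cong (_++ run (suc (i + suc a + suc b)) c) (run-++ 1 (i + suc a) (suc b)) ⟩
       (run 1 (i + suc a) ++ run (suc (i + suc a)) (suc b)) ++ run (suc (i + suc a + suc b)) c ≡⟨ cong (λ z → (z ++ run (suc (i + suc a)) (suc b)) ++ run (suc (i + suc a + suc b)) c) (run-++ 1 i (suc a)) ⟩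
       ((run 1 i ++ run (suc i) (suc a)) ++ run (suc (i + suc a)) (suc b)) ++ run (suc (i + suc a + suc b)) c
          ≡⟨ trans (++-assoc (run 1 i ++ run (suc i) (suc a)) (run (suc (i + suc a)) (suc b)) (run (suc (i + suc a + suc b)) c)) (++-assoc (run 1 i) (run (suc i) (suc a)) (run (suc (i + suc a)) (suc b) ++ run (suc (i + suc a + suc b)) c)) ⟩
       run 1 i ++ run (suc i) (suc a) ++ run (suc (i + suc a)) (suc b) ++ run (suc (i + suc a + suc b)) c ∎
      where open ≡-Reasoning

  length-σ : ∀ i a b c → Fits i a b c → length (σ⁺ i a b) ≡ n
  length-σ i a b c e = length≡n (Sym⇒Perm (σ-Sym i a b c e))

  map-++₅ : ∀ (f : ℕ → ℕ) A B C D E → map f (A ++ B ++ C ++ D ++ E) ≡ map f A ++ map f B ++ map f C ++ map f D ++ map f E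
  map-++₅ f A B C D E = trans (map-++ f A _) (cong (map f A ++_) (trans (map-++ f B _) (cong (map f B ++_) (trans (map-++ f C _) (cong (map f C ++_) (map-++ f D E))))))

  fbar-σ-shift : ∀ i a b c → Fits (suc i) a b c → fbar n 1 (σ⁺ (suc i) a b) ≡ σ⁺ i a b
  fbar-σ-shift i a b c e = begin
      fbar n 1 (σ n (suc i) j k) ≡⟨ cong (fbar n 1) e1 ⟩
      fbar n 1 (1 ∷ Y) ≡⟨ fbar≡rotation (1 ∷ Y) 1 refl (trans (cong length (sym e1)) (length-σ (suc i) a b c e)) (s≤s z≤n) ⟩
      map α⁻¹ (Y ++ 0 ∷ []) ≡⟨ cong (map α⁻¹) (trans (++-assoc (run 2 i) X (0 ∷ [])) (cong (run 2 i ++_) (trans (++-assoc (run (suc j) (suc b)) _ (0 ∷ []))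
                                (cong (run (suc j) (suc b) ++_) (++-assoc (run (suc (suc i)) (suc a)) (run (suc k) c) (0 ∷ [])))))) ⟩
      map α⁻¹ (run 2 i ++ run (suc j) (suc b) ++ run (suc (suc i)) (suc a) ++ run (suc k) c ++ 0 ∷ [])
        ≡⟨ map-++₅ α⁻¹ (run 2 i) (run (suc j) (suc b)) (run (suc (suc i)) (suc a)) (run (suc k) c) (0 ∷ []) ⟩
      map α⁻¹ (run 2 i) ++ map α⁻¹ (run (suc j) (suc b)) ++ map α⁻¹ (run (suc (suc i)) (suc a)) ++ map α⁻¹ (run (suc k) c) ++ α⁻¹ 0 ∷ []
        ≡⟨ cong₂ _++_ (map-α⁻¹-run 2 i (s≤s z≤n) (s≤s in')) (cong₂ _++_ (map-α⁻¹-run (suc j) (suc b) (s≤s z≤n) (s≤s kn))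
             (cong₂ _++_ (map-α⁻¹-run (suc (suc i)) (suc a) (s≤s z≤n) (s≤s jn))
               (cong₂ _++_ (map-α⁻¹-run (suc k) c (s≤s z≤n) (≤-reflexive (cong suc e))) (cong (_∷ []) α⁻¹-0)))) ⟩
      run 1 i ++ run j (suc b) ++ run (suc i) (suc a) ++ run k c ++ n ∷ []
        ≡⟨ cong (λ z → run 1 i ++ run j (suc b) ++ run (suc i) (suc a) ++ z) (sym (trans (run-∷ʳ k c) (cong (λ w → run k c ++ w ∷ []) e))) ⟩
      run 1 i ++ run j (suc b) ++ run (suc i) (suc a) ++ run k (suc c) ≡⟨ sym (σ≡runs i a b (suc c) (trans (+-suc (i + suc a + suc b) c) e)) ⟩
      σ⁺ i a b ∎
    where
    open ≡-Reasoning
    j = suc i + suc a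
    k = j + suc b
    X = run (suc j) (suc b) ++ run (suc (suc i)) (suc a) ++ run (suc k) c
    Y = run 2 i ++ X
    e1 : σ n (suc i) j k ≡ 1 ∷ Y
    e1 = trans (σ≡runs (suc i) a b c e) (cong (_++ X) (run-suc 1 i))
    kn : k ≤ n
    kn = +≡⇒≤ k c n e
    jn : j ≤ n
    jn = ≤-trans (m≤m+n j (suc b)) kn
    in' : suc i ≤ n
    in' = ≤-trans (m≤m+n (suc i) (suc a)) jn

  fbar-σ-wrap : ∀ a b c → Fits 0 a b c → fbar n 1 (σ⁺ 0 a b) ≡ σ⁺ a b c
  fbar-σ-wrap a b c e = begin
      fbar n 1 (σ n 0 (suc a) k) ≡⟨ cong (fbar n 1) e1 ⟩
      fbar n 1 (P ++ 1 ∷ Q) ≡⟨ fbar≡rotation (P ++ 1 ∷ Q) (suc (length P)) ep (trans (cong length (sym e1)) (length-σ 0 a b c e)) p≤ ⟩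
      map α⁻¹ (drop (suc (suc (length P))) (0 ∷ P ++ 1 ∷ Q) ++ take (suc (length P)) (0 ∷ P ++ 1 ∷ Q))
        ≡⟨ cong₂ (λ u v → map α⁻¹ (u ++ v)) (drop-++-∷ (0 ∷ P) 1 Q) (take-length-++ (0 ∷ P) (1 ∷ Q)) ⟩
      map α⁻¹ ((run 2 a ++ D) ++ 0 ∷ P) ≡⟨ cong (map α⁻¹) (++-assoc (run 2 a) D (0 ∷ P)) ⟩
      map α⁻¹ (run 2 a ++ D ++ 0 ∷ P) ≡⟨ trans (map-++ α⁻¹ (run 2 a) _) (cong (map α⁻¹ (run 2 a) ++_) (map-++ α⁻¹ D (0 ∷ P))) ⟩
      map α⁻¹ (run 2 a) ++ map α⁻¹ D ++ α⁻¹ 0 ∷ map α⁻¹ P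
        ≡⟨ cong₂ _++_ (map-α⁻¹-run 2 a (s≤s z≤n) (s≤s an)) (cong₂ _++_ (map-α⁻¹-run (suc k) c (s≤s z≤n) (≤-reflexive (cong suc e)))
             (cong₂ _∷_ α⁻¹-0 (map-α⁻¹-run (suc (suc a)) (suc b) (s≤s z≤n) (s≤s kn)))) ⟩
      run 1 a ++ run k c ++ n ∷ run (suc a) (suc b)
        ≡⟨ cong (run 1 a ++_) (trans (sym (++-assoc (run k c) (n ∷ []) (run (suc a) (suc b))))
             (cong₂ _++_ (sym (trans (run-∷ʳ k c) (cong (λ w → run k c ++ w ∷ []) e))) (sym (++-identityʳ (run (suc a) (suc b)))))) ⟩
      run 1 a ++ run k (suc c) ++ run (suc a) (suc b) ++ [] ≡⟨ sym (σ≡runs a b c 0 (trans (+-identityʳ _) (trans (+-suc (a + suc b) c) e))) ⟩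
      σ⁺ a b c ∎
    where
    open ≡-Reasoning
    k = suc a + suc b
    P = run (suc (suc a)) (suc b)
    D = run (suc k) c
    Q = run 2 a ++ D
    e1 : σ n 0 (suc a) k ≡ P ++ 1 ∷ Q
    e1 = trans (σ≡runs 0 a b c e) (cong (λ z → P ++ z ++ D) (run-suc 1 a))
    notin : 1 ∉ 0 ∷ P
    notin (here ())
    notin (there mm) = ⊥-elim (<-irrefl refl (≤-trans (s≤s (s≤s z≤n)) (proj₁ (∈-run⁻ (suc (suc a)) (suc b) mm))))
    ep : pos (0 ∷ P ++ 1 ∷ Q) 1 ≡ suc (length P)
    ep = trans (pos-++ (0 ∷ P) (1 ∷ Q) notin) (trans (cong (suc (length P) +_) (pos-head {1} Q)) (+-identityʳ (suc (length P))))
    kn : k ≤ n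
    kn = +≡⇒≤ k c n e
    an : suc a ≤ n
    an = ≤-trans (m≤m+n (suc a) (suc b)) kn
    p≤ : suc (length P) ≤ n
    p≤ = subst (_≤ n) (cong suc (sym (length-run (suc (suc a)) (suc b)))) (≤-trans (s≤s (m≤n+m (suc b) a)) kn)

  grev≡reverse : ∀ π → length π ≡ n → grev n π ≡ map (N ∸_) (reverse π)
  grev≡reverse π L = begin
      grev n π ≡⟨ cong (map f) range1n ⟩
      map f (run 1 n) ≡⟨ map-applyUpTo (λ x → 1 + x) f n ⟩
      applyUpTo (λ x → f (1 + x)) n ≡⟨ applyUpTo-cong _ _ n (λ i i< → cong (λ z → N ∸ app π z) (+-∸-assoc 1 i<)) ⟩
      applyUpTo (λ i → N ∸ at π (n ∸ suc i)) n ≡⟨ sym (map-applyUpTo (λ i → at π (n ∸ suc i)) (N ∸_) n) ⟩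
      map (N ∸_) (applyUpTo (λ i → at π (n ∸ suc i)) n) ≡⟨ cong (map (N ∸_)) (sym RV) ⟩
      map (N ∸_) (reverse π) ∎
    where
    open ≡-Reasoning
    f : ℕ → ℕ
    f t = N ∸ app π (N ∸ t)
    RV : reverse π ≡ applyUpTo (λ i → at π (n ∸ suc i)) n
    RV = trans (reverse-at π) (cong (λ ℓ → applyUpTo (λ i → at π (ℓ ∸ suc i)) ℓ) L)

  map-N∸-reverse-run : ∀ a k → a + k ≤ N → map (N ∸_) (reverse (run a k)) ≡ run (suc (N ∸ (a + k))) k
  map-N∸-reverse-run a zero b = refl
  map-N∸-reverse-run a (suc k) b = begin
      map (N ∸_) (reverse (run a (suc k))) ≡⟨ cong (λ z → map (N ∸_) (reverse z)) (run-∷ʳ a k) ⟩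
      map (N ∸_) (reverse (run a k ++ (a + k) ∷ [])) ≡⟨ cong (map (N ∸_)) (reverse-++ (run a k) ((a + k) ∷ [])) ⟩
      (N ∸ (a + k)) ∷ map (N ∸_) (reverse (run a k)) ≡⟨ cong ((N ∸ (a + k)) ∷_) (map-N∸-reverse-run a k b') ⟩
      (N ∸ (a + k)) ∷ run (suc (N ∸ (a + k))) k ≡⟨ sym (run-suc (N ∸ (a + k)) k) ⟩
      run (N ∸ (a + k)) (suc k) ≡⟨ cong (λ z → run z (suc k)) (trans (+-∸-assoc 1 (subst (_≤ N) (+-suc a k) b)) (cong (λ z → suc (N ∸ z)) (sym (+-suc a k)))) ⟩
      run (suc (N ∸ (a + suc k))) (suc k) ∎
    where
    open ≡-Reasoning
    b' : a + k ≤ N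
    b' = ≤-trans (+-monoʳ-≤ a (n≤1+n k)) b

  reverse-++₄ : ∀ (A B C D : List ℕ) → reverse (A ++ B ++ C ++ D) ≡ reverse D ++ reverse C ++ reverse B ++ reverse A
  reverse-++₄ A B C D = trans (reverse-++ A (B ++ C ++ D)) (trans (cong (_++ reverse A) (trans (reverse-++ B (C ++ D)) (cong (_++ reverse B) (reverse-++ C D))))
                   (trans (++-assoc (reverse D ++ reverse C) (reverse B) (reverse A)) (++-assoc (reverse D) (reverse C) (reverse B ++ reverse A))))

  +≡⇒∸≡ : ∀ x y z → x + y ≡ z → z ∸ x ≡ y
  +≡⇒∸≡ x y z e = trans (cong (_∸ x) (sym e)) (m+n∸m≡n x y)

  Fits-reverse : ∀ i a b c → Fits i a b c → Fits c b a i
  Fits-reverse i a b c = trans (solve 4 (λ i a b c → ((c :+ (con 1 :+ b)) :+ (con 1 :+ a)) :+ i := ((i :+ (con 1 :+ a)) :+ (con 1 :+ b)) :+ c) refl i a b c)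

  grev-σ : ∀ i a b c → Fits i a b c → grev n (σ⁺ i a b) ≡ σ⁺ c b a
  grev-σ i a b c e = begin
      grev n (σ n i j k) ≡⟨ grev≡reverse _ (length-σ i a b c e) ⟩
      map (N ∸_) (reverse (σ n i j k)) ≡⟨ cong (λ z → map (N ∸_) (reverse z)) (σ≡runs i a b c e) ⟩
      map (N ∸_) (reverse (A' ++ B' ++ C' ++ D')) ≡⟨ cong (map (N ∸_)) (reverse-++₄ A' B' C' D') ⟩
      map (N ∸_) (reverse D' ++ reverse C' ++ reverse B' ++ reverse A')
        ≡⟨ trans (map-++ (N ∸_) (reverse D') _) (cong (map (N ∸_) (reverse D') ++_) (trans (map-++ (N ∸_) (reverse C') _) (cong (map (N ∸_) (reverse C') ++_) (map-++ (N ∸_) (reverse B') (reverse A'))))) ⟩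
      map (N ∸_) (reverse D') ++ map (N ∸_) (reverse C') ++ map (N ∸_) (reverse B') ++ map (N ∸_) (reverse A')
        ≡⟨ cong₂ _++_ (trans (map-N∸-reverse-run (suc k) c (≤-reflexive (cong suc e))) (cong (λ z → run (suc z) c) (trans (cong (N ∸_) (cong suc e)) (n∸n≡0 N))))
             (cong₂ _++_ (trans (map-N∸-reverse-run (suc i) (suc a) (s≤s jn)) (cong (λ z → run (suc z) (suc a)) (+≡⇒∸≡ j (c + suc b) n ej)))
               (cong₂ _++_ (trans (map-N∸-reverse-run (suc j) (suc b) (s≤s kn)) (cong (λ z → run (suc z) (suc b)) (+≡⇒∸≡ k c n e)))
                 (trans (map-N∸-reverse-run 1 i (s≤s in')) (cong (λ z → run (suc z) i) (+≡⇒∸≡ i (c + suc b + suc a) n ei))))) ⟩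
      run 1 c ++ run (suc (c + suc b)) (suc a) ++ run (suc c) (suc b) ++ run (suc (c + suc b + suc a)) i
        ≡⟨ sym (σ≡runs c b a i (Fits-reverse i a b c e)) ⟩
      σ⁺ c b a ∎
    where
    open ≡-Reasoning
    j = i + suc a
    k = j + suc b
    A' = run 1 i
    B' = run (suc j) (suc b)
    C' = run (suc i) (suc a)
    D' = run (suc k) c
    kn : k ≤ n
    kn = +≡⇒≤ k c n e
    jn : j ≤ n
    jn = ≤-trans (m≤m+n j (suc b)) kn
    in' : i ≤ n
    in' = ≤-trans (m≤m+n i (suc a)) jn
    ej : j + (c + suc b) ≡ n
    ej = trans (solve 4 (λ i a b c → (i :+ (con 1 :+ a)) :+ (c :+ (con 1 :+ b)) := ((i :+ (con 1 :+ a)) :+ (con 1 :+ b)) :+ c) refl i a b c) e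
    ei : i + (c + suc b + suc a) ≡ n
    ei = trans (solve 4 (λ i a b c → i :+ ((c :+ (con 1 :+ b)) :+ (con 1 :+ a)) := ((i :+ (con 1 :+ a)) :+ (con 1 :+ b)) :+ c) refl i a b c) e

  BlockTransposition : List ℕ → Set
  BlockTransposition x = Σ ℕ λ i → Σ ℕ λ a → Σ ℕ λ b → Σ ℕ λ c → Fits i a b c × x ≡ σ⁺ i a b

  bt-perm : ∀ {x} → BlockTransposition x → Perm x
  bt-perm (i , a , b , c , v , refl) = Sym⇒Perm (σ-Sym i a b c v)

  bt-fbar : ∀ {x} → BlockTransposition x → BlockTransposition (fbar n 1 x)
  bt-fbar (suc i , a , b , c , v , refl) = i , a , b , suc c , trans (+-suc (i + suc a + suc b) c) v , fbar-σ-shift i a b c v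
  bt-fbar (zero , a , b , c , v , refl) = a , b , c , 0 , trans (+-identityʳ _) (trans (+-suc (a + suc b) c) v) , fbar-σ-wrap a b c v

  bt-fbar^ : ∀ {x} → BlockTransposition x → ∀ k → BlockTransposition (fbar^ k x)
  bt-fbar^ t zero = t
  bt-fbar^ t (suc k) = bt-fbar (bt-fbar^ t k)

  bt-grev : ∀ {x} → BlockTransposition x → BlockTransposition (grev n x)
  bt-grev (i , a , b , c , v , refl) = c , b , a , i , Fits-reverse i a b c v , grev-σ i a b c v

  σ-bt : ∀ {i j k} → i < j → j < k → k ≤ n → BlockTransposition (σ n i j k)
  σ-bt {i} {j} {k} ij jk kn with m≤n⇒∃[o]m+o≡n ij | m≤n⇒∃[o]m+o≡n jk | m≤n⇒∃[o]m+o≡n kn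
  ... | a , ea | b , eb | c , ec = i , a , b , c , V' , cong₂ (σ n i) (sym Jeq) (sym Keq)
    where
    Jeq : i + suc a ≡ j
    Jeq = trans (+-suc i a) ea
    Keq : i + suc a + suc b ≡ k
    Keq = trans (cong (_+ suc b) Jeq) (trans (+-suc j b) eb)
    V' : Fits i a b c
    V' = trans (cong (_+ c) Keq) ec

  bt⇒Adj : ∀ {π ρ x} → BlockTransposition x → ρ ≡ π ∘ₚ x → Adj n π ρ
  bt⇒Adj {π} {ρ} (i , a , b , c , v , refl) e =
    i , i + suc a , i + suc a + suc b , m<m+n i (s≤s z≤n) , m<m+n (i + suc a) (s≤s z≤n) , +≡⇒≤ _ c n v , e

  Adj⇒bt : ∀ {π ρ} → Adj n π ρ → Σ (List ℕ) λ x → BlockTransposition x × ρ ≡ π ∘ₚ x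
  Adj⇒bt (i , j , k , ij , jk , kn , e) = σ n i j k , σ-bt ij jk kn , e

  Adj-fbar : ∀ {π ρ} → Sym n π → Sym n ρ → Adj n π ρ → Adj n (fbar n 1 π) (fbar n 1 ρ)
  Adj-fbar {π} {ρ} sπ sρ ad with Adj⇒bt ad
  ... | x , t , e = bt⇒Adj (bt-fbar^ t (pos (0 ∷ π) 1))
        (trans (cong (fbar n 1) e) (fbar-∘ₚ (Sym⇒Perm sπ) (bt-perm t) (subst Perm e (Sym⇒Perm sρ))))

  Adj-grev : ∀ {π ρ} → Sym n π → Sym n ρ → Adj n π ρ → Adj n (grev n π) (grev n ρ)
  Adj-grev {π} {ρ} sπ sρ ad with Adj⇒bt ad
  ... | x , t , e = bt⇒Adj (bt-grev t) (trans (cong (grev n) e) (grev-∘ₚ (Sym⇒Perm sπ) (bt-perm t)))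


module ToricReverseGroup (m : ℕ) where

  open BlockTranspositions m public

  word : ℕ → Bool → List ℕ → List ℕ
  word a false π = fbar^ a π
  word a true π = fbar^ a (grev n π)

  word-perm : ∀ {π} → Perm π → ∀ a b → Perm (word a b π)
  word-perm g a false = fbar^-perm g a
  word-perm g a true = fbar^-perm (grev-perm g) a

  word-Sym : ∀ {π} → Sym n π → ∀ a b → Sym n (word a b π)
  word-Sym s a b = Perm⇒Sym (word-perm (Sym⇒Perm s) a b)

  inverseExp : ℕ → Bool → ℕ
  inverseExp a false = a * n
  inverseExp a true = a

  word-inverseʳ : ∀ {π} → Perm π → ∀ a b → word a b (word (inverseExp a b) b π) ≡ π
  word-inverseʳ {π} g a false = trans (sym (fbar^-+ a (a * n) π)) (fbar^-k+k*n g a)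
  word-inverseʳ {π} g a true = trans (cong (fbar^ a) (grev-fbar^ (grev-perm g) a)) (trans (cong (λ z → fbar^ a (fbar^ (a * n) z)) (grev-involutive g))
                          (trans (sym (fbar^-+ a (a * n) π)) (fbar^-k+k*n g a)))

  word-inverseˡ : ∀ {π} → Perm π → ∀ a b → word (inverseExp a b) b (word a b π) ≡ π
  word-inverseˡ {π} g a false = trans (sym (fbar^-+ (a * n) a π)) (fbar^-k*n+k g a)
  word-inverseˡ {π} g a true = word-inverseʳ g a true

  composeExp : ℕ → Bool → ℕ → ℕ
  composeExp a false a' = a + a'
  composeExp a true a' = a + a' * n

  composeRefl : Bool → Bool → Bool
  composeRefl false b' = b'
  composeRefl true false = true
  composeRefl true true = false

  word-∘ : ∀ {π} → Perm π → ∀ a b a' b' → word a b (word a' b' π) ≡ word (composeExp a b a') (composeRefl b b') π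
  word-∘ {π} g a false a' false = sym (fbar^-+ a a' π)
  word-∘ {π} g a false a' true = sym (fbar^-+ a a' (grev n π))
  word-∘ {π} g a true a' false = trans (cong (fbar^ a) (grev-fbar^ g a')) (sym (fbar^-+ a (a' * n) (grev n π)))
  word-∘ {π} g a true a' true = trans (cong (fbar^ a) (grev-fbar^ (grev-perm g) a')) (trans (cong (λ z → fbar^ a (fbar^ (a' * n) z)) (grev-involutive g)) (sym (fbar^-+ a (a' * n) π)))

  InD-fbar^ : ∀ k → InD n (fbar^ k)
  InD-fbar^ zero = idD
  InD-fbar^ (suc k) = comp gen-f (InD-fbar^ k)

  InD-word : ∀ a b → InD n (word a b)
  InD-word a false = InD-fbar^ a
  InD-word a true = comp (InD-fbar^ a) gen-g

  IsWord : (List ℕ → List ℕ) → Set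
  IsWord d = Σ ℕ λ a → Σ Bool λ b → ∀ π → Sym n π → d π ≡ word a b π

  InD⇒IsWord : ∀ {d} → InD n d → IsWord d
  InD⇒IsWord gen-f = 1 , false , λ π s → refl
  InD⇒IsWord gen-g = 0 , true , λ π s → refl
  InD⇒IsWord idD = 0 , false , λ π s → refl
  InD⇒IsWord (comp {d} {e} D E) with InD⇒IsWord D | InD⇒IsWord E
  ... | a , b , eq1 | a' , b' , eq2 = composeExp a b a' , composeRefl b b' , λ π s →
        trans (cong d (eq2 π s)) (trans (eq1 (word a' b' π) (word-Sym s a' b')) (word-∘ (Sym⇒Perm s) a b a' b'))
  InD⇒IsWord (inv {d} {d'} D l r) with InD⇒IsWord D
  ... | a , b , eq = inverseExp a b , b , λ π s →
        trans (cong d' (sym (trans (eq (word (inverseExp a b) b π) (word-Sym s (inverseExp a b) b)) (word-inverseʳ (Sym⇒Perm s) a b))))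
              (l (word (inverseExp a b) b π) (word-Sym s (inverseExp a b) b))

  Adj-fbar^ : ∀ k {x y} → Sym n x → Sym n y → Adj n x y → Adj n (fbar^ k x) (fbar^ k y)
  Adj-fbar^ zero sx sy ad = ad
  Adj-fbar^ (suc k) sx sy ad = Adj-fbar (word-Sym sx k false) (word-Sym sy k false) (Adj-fbar^ k sx sy ad)

  Adj-word : ∀ a b {x y} → Sym n x → Sym n y → Adj n x y → Adj n (word a b x) (word a b y)
  Adj-word a false sx sy ad = Adj-fbar^ a sx sy ad
  Adj-word a true sx sy ad = Adj-fbar^ a (Perm⇒Sym (grev-perm (Sym⇒Perm sx))) (Perm⇒Sym (grev-perm (Sym⇒Perm sy))) (Adj-grev sx sy ad)

  Adj-word⁻ : ∀ a b {x y} → Sym n x → Sym n y → Adj n (word a b x) (word a b y) → Adj n x y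
  Adj-word⁻ a b {x} {y} sx sy ad = subst₂ (Adj n) (word-inverseˡ (Sym⇒Perm sx) a b) (word-inverseˡ (Sym⇒Perm sy) a b)
    (Adj-word (inverseExp a b) b (word-Sym sx a b) (word-Sym sy a b) ad)


module VertexSet (m₀ : ℕ) where

  open ToricReverseGroup (suc (suc m₀)) public

  -- vA l and vB l are the endpoints of e_l (l ≤ n − 3); v1, v2 those of e_{n−2}; v3, v4 of e_{n−1}; v5, v6 of e_n.
  data InV : List ℕ → Set where
    vA : ∀ l → l ≤ m₀ → InV (σ⁺ l 0 1)
    vB : ∀ l → l ≤ m₀ → InV (σ⁺ l 1 0)
    v1 : InV (σ⁺ 0 m₀ 0)
    v2 : InV (σ⁺ 0 m₀ 1)
    v3 : InV (σ⁺ 1 m₀ 0)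
    v4 : InV (σ⁺ 0 0 m₀)
    v5 : InV (σ⁺ 0 1 m₀)
    v6 : InV (σ⁺ 1 0 m₀)

  fitsA : ∀ l → l ≤ m₀ → Fits l 0 1 (m₀ ∸ l)
  fitsA l p = trans (solve 2 (λ l x → l :+ con 1 :+ con 2 :+ x := con 3 :+ (l :+ x)) refl l (m₀ ∸ l)) (cong (3 +_) (m+[n∸m]≡n p))

  fitsB : ∀ l → l ≤ m₀ → Fits l 1 0 (m₀ ∸ l)
  fitsB l p = trans (solve 2 (λ l x → l :+ con 2 :+ con 1 :+ x := con 3 :+ (l :+ x)) refl l (m₀ ∸ l)) (cong (3 +_) (m+[n∸m]≡n p))

  fits1 : Fits 0 m₀ 0 1
  fits1 = solve 1 (λ x → con 1 :+ x :+ con 1 :+ con 1 := con 3 :+ x) refl m₀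
  fits2 : Fits 0 m₀ 1 0
  fits2 = solve 1 (λ x → con 1 :+ x :+ con 2 :+ con 0 := con 3 :+ x) refl m₀
  fits3 : Fits 1 m₀ 0 0
  fits3 = solve 1 (λ x → con 1 :+ (con 1 :+ x) :+ con 1 :+ con 0 := con 3 :+ x) refl m₀
  fits4 : Fits 0 0 m₀ 1
  fits4 = solve 1 (λ x → con 1 :+ (con 1 :+ x) :+ con 1 := con 3 :+ x) refl m₀
  fits5 : Fits 0 1 m₀ 0
  fits5 = solve 1 (λ x → con 2 :+ (con 1 :+ x) :+ con 0 := con 3 :+ x) refl m₀
  fits6 : Fits 1 0 m₀ 0
  fits6 = solve 1 (λ x → con 2 :+ (con 1 :+ x) :+ con 0 := con 3 :+ x) refl m₀

  InV-bt : ∀ {x} → InV x → BlockTransposition x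
  InV-bt (vA l p) = l , 0 , 1 , m₀ ∸ l , fitsA l p , refl
  InV-bt (vB l p) = l , 1 , 0 , m₀ ∸ l , fitsB l p , refl
  InV-bt v1 = 0 , m₀ , 0 , 1 , fits1 , refl
  InV-bt v2 = 0 , m₀ , 1 , 0 , fits2 , refl
  InV-bt v3 = 1 , m₀ , 0 , 0 , fits3 , refl
  InV-bt v4 = 0 , 0 , m₀ , 1 , fits4 , refl
  InV-bt v5 = 0 , 1 , m₀ , 0 , fits5 , refl
  InV-bt v6 = 1 , 0 , m₀ , 0 , fits6 , refl

  InV-perm : ∀ {x} → InV x → Perm x
  InV-perm v = bt-perm (InV-bt v)

  InV-Sym : ∀ {x} → InV x → Sym n x
  InV-Sym v = Perm⇒Sym (InV-perm v)

  fbar-vA : ∀ l → suc l ≤ m₀ → fbar n 1 (σ⁺ (suc l) 0 1) ≡ σ⁺ l 0 1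
  fbar-vA l p = fbar-σ-shift l 0 1 (m₀ ∸ suc l) (fitsA (suc l) p)
  fbar-vB : ∀ l → suc l ≤ m₀ → fbar n 1 (σ⁺ (suc l) 1 0) ≡ σ⁺ l 1 0
  fbar-vB l p = fbar-σ-shift l 1 0 (m₀ ∸ suc l) (fitsB (suc l) p)
  fbar-vA0 : fbar n 1 (σ⁺ 0 0 1) ≡ σ⁺ 0 1 m₀
  fbar-vA0 = fbar-σ-wrap 0 1 m₀ refl
  fbar-vB0 : fbar n 1 (σ⁺ 0 1 0) ≡ σ⁺ 1 0 m₀
  fbar-vB0 = fbar-σ-wrap 1 0 m₀ refl
  fbar-v1 : fbar n 1 (σ⁺ 0 m₀ 0) ≡ σ⁺ m₀ 0 1
  fbar-v1 = fbar-σ-wrap m₀ 0 1 fits1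
  fbar-v2 : fbar n 1 (σ⁺ 0 m₀ 1) ≡ σ⁺ m₀ 1 0
  fbar-v2 = fbar-σ-wrap m₀ 1 0 fits2
  fbar-v3 : fbar n 1 (σ⁺ 1 m₀ 0) ≡ σ⁺ 0 m₀ 0
  fbar-v3 = fbar-σ-shift 0 m₀ 0 0 fits3
  fbar-v4 : fbar n 1 (σ⁺ 0 0 m₀) ≡ σ⁺ 0 m₀ 1
  fbar-v4 = fbar-σ-wrap 0 m₀ 1 fits4
  fbar-v5 : fbar n 1 (σ⁺ 0 1 m₀) ≡ σ⁺ 1 m₀ 0
  fbar-v5 = fbar-σ-wrap 1 m₀ 0 fits5
  fbar-v6 : fbar n 1 (σ⁺ 1 0 m₀) ≡ σ⁺ 0 0 m₀
  fbar-v6 = fbar-σ-shift 0 0 m₀ 0 fits6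

  InV-fbar : ∀ {x} → InV x → InV (fbar n 1 x)
  InV-fbar (vA (suc l) p) = subst InV (sym (fbar-vA l p)) (vA l (≤-trans (n≤1+n l) p))
  InV-fbar (vA zero p) = subst InV (sym fbar-vA0) v5
  InV-fbar (vB (suc l) p) = subst InV (sym (fbar-vB l p)) (vB l (≤-trans (n≤1+n l) p))
  InV-fbar (vB zero p) = subst InV (sym fbar-vB0) v6
  InV-fbar v1 = subst InV (sym fbar-v1) (vA m₀ ≤-refl)
  InV-fbar v2 = subst InV (sym fbar-v2) (vB m₀ ≤-refl)
  InV-fbar v3 = subst InV (sym fbar-v3) v1
  InV-fbar v4 = subst InV (sym fbar-v4) v2
  InV-fbar v5 = subst InV (sym fbar-v5) v3
  InV-fbar v6 = subst InV (sym fbar-v6) v4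

  InV-fbar^ : ∀ {x} → InV x → ∀ k → InV (fbar^ k x)
  InV-fbar^ v zero = v
  InV-fbar^ v (suc k) = InV-fbar (InV-fbar^ v k)

  InV-grev : ∀ {x} → InV x → InV (grev n x)
  InV-grev (vA l p) = subst InV (sym (grev-σ l 0 1 (m₀ ∸ l) (fitsA l p))) (vB (m₀ ∸ l) (m∸n≤m m₀ l))
  InV-grev (vB l p) = subst InV (sym (grev-σ l 1 0 (m₀ ∸ l) (fitsB l p))) (vA (m₀ ∸ l) (m∸n≤m m₀ l))
  InV-grev v1 = subst InV (sym (grev-σ 0 m₀ 0 1 fits1)) v6
  InV-grev v2 = subst InV (sym (grev-σ 0 m₀ 1 0 fits2)) v5
  InV-grev v3 = subst InV (sym (grev-σ 1 m₀ 0 0 fits3)) v4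
  InV-grev v4 = subst InV (sym (grev-σ 0 0 m₀ 1 fits4)) v3
  InV-grev v5 = subst InV (sym (grev-σ 0 1 m₀ 0 fits5)) v2
  InV-grev v6 = subst InV (sym (grev-σ 1 0 m₀ 0 fits6)) v1

  InV-word : ∀ {x} → InV x → ∀ a b → InV (word a b x)
  InV-word v a false = InV-fbar^ v a
  InV-word v a true = InV-fbar^ (InV-grev v) a

  edgeAt : ℕ → List ℕ × List ℕ
  edgeAt l = (σ n l (l + 1) (l + 3) , σ n l (l + 2) (l + 3))

  lastEdges : List (List ℕ × List ℕ)
  lastEdges = (σ n 0 (n ∸ 2) (n ∸ 1) , σ n 0 (n ∸ 2) n) ∷ (σ n 1 (n ∸ 1) n , σ n 0 1 (n ∸ 1)) ∷ (σ n 0 2 n , σ n 1 2 n) ∷ []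

  σ⁺-A : ∀ l → σ⁺ l 0 1 ≡ σ n l (l + 1) (l + 3)
  σ⁺-A l = cong (σ n l (l + 1)) (+-assoc l 1 2)

  σ⁺-B : ∀ l → σ⁺ l 1 0 ≡ σ n l (l + 2) (l + 3)
  σ⁺-B l = cong (σ n l (l + 2)) (+-assoc l 2 1)

  σ⁺-1 : σ⁺ 0 m₀ 0 ≡ σ n 0 (n ∸ 2) (n ∸ 1)
  σ⁺-1 = cong (σ n 0 (suc m₀)) (+-comm (suc m₀) 1)

  σ⁺-2 : σ⁺ 0 m₀ 1 ≡ σ n 0 (n ∸ 2) n
  σ⁺-2 = cong (σ n 0 (suc m₀)) (+-comm (suc m₀) 2)

  σ⁺-3 : σ⁺ 1 m₀ 0 ≡ σ n 1 (n ∸ 1) n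
  σ⁺-3 = cong (σ n 1 (suc (suc m₀))) (+-comm (suc (suc m₀)) 1)

  edgeAt-endpoint⇒InV : ∀ {x l} → l ≤ m₀ → x ≡ proj₁ (edgeAt l) ⊎ x ≡ proj₂ (edgeAt l) → InV x
  edgeAt-endpoint⇒InV {l = l} p (inj₁ refl) = subst InV (σ⁺-A l) (vA l p)
  edgeAt-endpoint⇒InV {l = l} p (inj₂ refl) = subst InV (σ⁺-B l) (vB l p)

  lastEdge-endpoint⇒InV : ∀ {x e} → e ∈ lastEdges → x ≡ proj₁ e ⊎ x ≡ proj₂ e → InV x
  lastEdge-endpoint⇒InV (here refl)                 (inj₁ refl) = subst InV σ⁺-1 v1
  lastEdge-endpoint⇒InV (here refl)                 (inj₂ refl) = subst InV σ⁺-2 v2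
  lastEdge-endpoint⇒InV (there (here refl))         (inj₁ refl) = subst InV σ⁺-3 v3
  lastEdge-endpoint⇒InV (there (here refl))         (inj₂ refl) = v4
  lastEdge-endpoint⇒InV (there (there (here refl))) (inj₁ refl) = v5
  lastEdge-endpoint⇒InV (there (there (here refl))) (inj₂ refl) = v6

  endpoint⇒InV : ∀ {x e} → e ∈ edges n → x ≡ proj₁ e ⊎ x ≡ proj₂ e → InV x
  endpoint⇒InV e∈ x≡ with ∈-++⁻ (map edgeAt (upTo (n ∸ 2))) e∈
  ... | inj₂ e∈ₗ = lastEdge-endpoint⇒InV e∈ₗ x≡
  ... | inj₁ e∈ₘ with ∈-map⁻ edgeAt e∈ₘ
  ...   | l , l∈ , refl = edgeAt-endpoint⇒InV (≤-pred (∈-upTo⁻ l∈)) x≡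

  ∈V⇒InV : ∀ {x} → x ∈ V n → InV x
  ∈V⇒InV x∈ with ∈-concatMap-pairs⁻ (edges n) x∈
  ... | e , e∈ , x≡ = endpoint⇒InV e∈ x≡

  edgeAt∈edges : ∀ {l} → l ≤ m₀ → edgeAt l ∈ edges n
  edgeAt∈edges p = ∈-++⁺ˡ (∈-map⁺ edgeAt (∈-upTo⁺ (s≤s p)))

  lastEdge∈edges : ∀ {e} → e ∈ lastEdges → e ∈ edges n
  lastEdge∈edges = ∈-++⁺ʳ (map edgeAt (upTo (n ∸ 2)))

  InV⇒∈V : ∀ {x} → InV x → x ∈ V n
  InV⇒∈V (vA l p) = subst (_∈ V n) (sym (σ⁺-A l)) (∈-concatMap-pairs⁺ˡ (edges n) (edgeAt∈edges p))
  InV⇒∈V (vB l p) = subst (_∈ V n) (sym (σ⁺-B l)) (∈-concatMap-pairs⁺ʳ (edges n) (edgeAt∈edges p))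
  InV⇒∈V v1 = subst (_∈ V n) (sym σ⁺-1) (∈-concatMap-pairs⁺ˡ (edges n) (lastEdge∈edges (here refl)))
  InV⇒∈V v2 = subst (_∈ V n) (sym σ⁺-2) (∈-concatMap-pairs⁺ʳ (edges n) (lastEdge∈edges (here refl)))
  InV⇒∈V v3 = subst (_∈ V n) (sym σ⁺-3) (∈-concatMap-pairs⁺ˡ (edges n) (lastEdge∈edges (there (here refl))))
  InV⇒∈V v4 = ∈-concatMap-pairs⁺ʳ (edges n) (lastEdge∈edges (there (here refl)))
  InV⇒∈V v5 = ∈-concatMap-pairs⁺ˡ (edges n) (lastEdge∈edges (there (there (here refl))))
  InV⇒∈V v6 = ∈-concatMap-pairs⁺ʳ (edges n) (lastEdge∈edges (there (there (here refl))))

  base : Bool → List ℕ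
  base false = σ⁺ 0 0 1
  base true = σ⁺ 0 1 0

  base-InV : ∀ s → InV (base s)
  base-InV false = vA 0 z≤n
  base-InV true = vB 0 z≤n

  base-perm : ∀ s → Perm (base s)
  base-perm s = InV-perm (base-InV s)

  fbar^-vA : ∀ l → l ≤ m₀ → fbar^ l (σ⁺ l 0 1) ≡ σ⁺ 0 0 1
  fbar^-vA zero p = refl
  fbar^-vA (suc l) p = trans (fbar^-sucʳ l _) (trans (cong (fbar^ l) (fbar-vA l p)) (fbar^-vA l (≤-trans (n≤1+n l) p)))

  fbar^-vB : ∀ l → l ≤ m₀ → fbar^ l (σ⁺ l 1 0) ≡ σ⁺ 0 1 0
  fbar^-vB zero p = refl
  fbar^-vB (suc l) p = trans (fbar^-sucʳ l _) (trans (cong (fbar^ l) (fbar-vB l p)) (fbar^-vB l (≤-trans (n≤1+n l) p)))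

  l≤N : ∀ {l} → l ≤ m₀ → l ≤ N
  l≤N p = ≤-trans p (≤-trans (n≤1+n _) (≤-trans (n≤1+n _) (≤-trans (n≤1+n _) (n≤1+n _))))

  InV⇒orbit : ∀ {x} → InV x → Σ ℕ λ k → Σ Bool λ s → x ≡ fbar^ k (base s)
  InV⇒orbit (vA l p) = N ∸ l , false , fbar^-complement l (InV-perm (vA l p)) (l≤N p) (fbar^-vA l p)
  InV⇒orbit (vB l p) = N ∸ l , true , fbar^-complement l (InV-perm (vB l p)) (l≤N p) (fbar^-vB l p)
  InV⇒orbit v5 = 1 , false , sym fbar-vA0
  InV⇒orbit v3 = 2 , false , sym (trans (cong (fbar n 1) fbar-vA0) fbar-v5)
  InV⇒orbit v1 = 3 , false , sym (trans (cong (λ z → fbar n 1 (fbar n 1 z)) fbar-vA0) (trans (cong (fbar n 1) fbar-v5) fbar-v3))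
  InV⇒orbit v6 = 1 , true , sym fbar-vB0
  InV⇒orbit v4 = 2 , true , sym (trans (cong (fbar n 1) fbar-vB0) fbar-v6)
  InV⇒orbit v2 = 3 , true , sym (trans (cong (λ z → fbar n 1 (fbar n 1 z)) fbar-vB0) (trans (cong (fbar n 1) fbar-v6) fbar-v4))

  K : ℕ
  K = N ∸ m₀

  grev-base : ∀ s → grev n (base s) ≡ fbar^ K (base (not s))
  grev-base false = trans (grev-σ 0 0 1 m₀ (fitsA 0 z≤n)) (fbar^-complement m₀ (InV-perm (vB m₀ ≤-refl)) (l≤N ≤-refl) (fbar^-vB m₀ ≤-refl))
  grev-base true = trans (grev-σ 0 1 0 m₀ (fitsB 0 z≤n)) (fbar^-complement m₀ (InV-perm (vA m₀ ≤-refl)) (l≤N ≤-refl) (fbar^-vA m₀ ≤-refl))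

  grev-orbit : ∀ s k → grev n (fbar^ k (base s)) ≡ fbar^ (k * n + K) (base (not s))
  grev-orbit s k = begin
    grev n (fbar^ k (base s))                    ≡⟨ grev-fbar^ (base-perm s) k ⟩
    fbar^ (k * n) (grev n (base s))              ≡⟨ cong (fbar^ (k * n)) (grev-base s) ⟩
    fbar^ (k * n) (fbar^ K (base (not s)))       ≡⟨ sym (fbar^-+ (k * n) K (base (not s))) ⟩
    fbar^ (k * n + K) (base (not s))             ∎
    where open ≡-Reasoning

  fbar^-across : ∀ s k k' → word (k' + (k * n + K) * n) true (fbar^ k (base s)) ≡ fbar^ k' (base (not s))
  fbar^-across s k k' = trans (cong (fbar^ (k' + (k * n + K) * n)) (grev-orbit s k)) (fbar^-within (base-perm (not s)) (k * n + K) k')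

  word-between : ∀ {v w} → InV v → InV w → Σ ℕ λ a → Σ Bool λ b → word a b v ≡ w
  word-between vv vw with InV⇒orbit vv | InV⇒orbit vw
  ... | k , false , refl | k' , false , refl = k' + k * n , false , fbar^-within (base-perm false) k k'
  ... | k , true , refl | k' , true , refl = k' + k * n , false , fbar^-within (base-perm true) k k'
  ... | k , false , refl | k' , true , refl = k' + (k * n + K) * n , true , fbar^-across false k k'
  ... | k , true , refl | k' , false , refl = k' + (k * n + K) * n , true , fbar^-across true k k'

  mapsOnto-fbar : ∀ r → r ≤ n → MapsOnto n (fbar n r)
  mapsOnto-fbar r r≤ = (λ π mm → InV⇒∈V (subst InV (sym (fbar≡fbar^ (InV-perm (∈V⇒InV mm)) r r≤)) (InV-fbar^ (∈V⇒InV mm) r)))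
             , (λ y mm → let ve = ∈V⇒InV mm in fbar^ (r * n) y , InV⇒∈V (InV-fbar^ ve (r * n)) ,
                   trans (fbar≡fbar^ (InV-perm (InV-fbar^ ve (r * n))) r r≤) (trans (sym (fbar^-+ r (r * n) y)) (fbar^-k+k*n (InV-perm ve) r)))

  mapsOnto-grev : MapsOnto n (grev n)
  mapsOnto-grev = (λ π mm → InV⇒∈V (InV-grev (∈V⇒InV mm))) , (λ y mm → grev n y , InV⇒∈V (InV-grev (∈V⇒InV mm)) , grev-involutive (InV-perm (∈V⇒InV mm)))

  mapsOnto-word : ∀ a b → MapsOnto n (word a b)
  mapsOnto-word a b = (λ π mm → InV⇒∈V (InV-word (∈V⇒InV mm) a b))
            , (λ y mm → word (inverseExp a b) b y , InV⇒∈V (InV-word (∈V⇒InV mm) (inverseExp a b) b) , word-inverseʳ (InV-perm (∈V⇒InV mm)) a b)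

  word-aut : ∀ a b → IsAutΓV n (word a b)
  word-aut a b = mapsOnto-word a b
           , (λ x y mx my e → trans (sym (word-inverseˡ (InV-perm (∈V⇒InV mx)) a b)) (trans (cong (word (inverseExp a b) b) e) (word-inverseˡ (InV-perm (∈V⇒InV my)) a b)))
           , (λ x y mx my → Adj-word a b (InV-Sym (∈V⇒InV mx)) (InV-Sym (∈V⇒InV my)) , Adj-word⁻ a b (InV-Sym (∈V⇒InV mx)) (InV-Sym (∈V⇒InV my)))

  transitive : ∀ v w → v ∈ V n → w ∈ V n → Σ (List ℕ → List ℕ) λ d → InD n d × d v ≡ w
  transitive v w mv mw with word-between (∈V⇒InV mv) (∈V⇒InV mw)
  ... | a , b , e = word a b , InD-word a b , e

  vertexTransitive : VertexTransitiveΓV n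
  vertexTransitive v w mv mw with word-between (∈V⇒InV mv) (∈V⇒InV mw)
  ... | a , b , e = word a b , word-aut a b , e


module Regularity (m₁ : ℕ) where

  open VertexSet (suc (suc m₁)) public

  m₀ : ℕ
  m₀ = suc (suc m₁)

  orbitA : ℕ → List ℕ
  orbitA 0 = σ⁺ 0 0 1
  orbitA 1 = σ⁺ 0 1 m₀
  orbitA 2 = σ⁺ 1 m₀ 0
  orbitA 3 = σ⁺ 0 m₀ 0
  orbitA (suc (suc (suc (suc j)))) = σ⁺ (m₀ ∸ j) 0 1

  orbitB : ℕ → List ℕ
  orbitB 0 = σ⁺ 0 1 0
  orbitB 1 = σ⁺ 1 0 m₀
  orbitB 2 = σ⁺ 0 0 m₀
  orbitB 3 = σ⁺ 0 m₀ 1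
  orbitB (suc (suc (suc (suc j)))) = σ⁺ (m₀ ∸ j) 1 0

  orbit : Bool → ℕ → List ℕ
  orbit false = orbitA
  orbit true = orbitB

  jbound : ∀ j → 4 + j ≤ n → j < m₀
  jbound j (s≤s (s≤s (s≤s p))) = p

  fbar-orbitA : ∀ r → suc r ≤ n → fbar n 1 (orbitA r) ≡ orbitA (suc r)
  fbar-orbitA 0 _ = fbar-vA0
  fbar-orbitA 1 _ = fbar-v5
  fbar-orbitA 2 _ = fbar-v3
  fbar-orbitA 3 _ = fbar-v1
  fbar-orbitA (suc (suc (suc (suc j)))) p = let j< = jbound j (≤-trans (n≤1+n _) p) in
    trans (cong (λ z → fbar n 1 (σ⁺ z 0 1)) (+-∸-assoc 1 j<)) (fbar-vA (m₀ ∸ suc j) (subst (_≤ m₀) (+-∸-assoc 1 j<) (m∸n≤m m₀ j)))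

  fbar-orbitB : ∀ r → suc r ≤ n → fbar n 1 (orbitB r) ≡ orbitB (suc r)
  fbar-orbitB 0 _ = fbar-vB0
  fbar-orbitB 1 _ = fbar-v6
  fbar-orbitB 2 _ = fbar-v4
  fbar-orbitB 3 _ = fbar-v2
  fbar-orbitB (suc (suc (suc (suc j)))) p = let j< = jbound j (≤-trans (n≤1+n _) p) in
    trans (cong (λ z → fbar n 1 (σ⁺ z 1 0)) (+-∸-assoc 1 j<)) (fbar-vB (m₀ ∸ suc j) (subst (_≤ m₀) (+-∸-assoc 1 j<) (m∸n≤m m₀ j)))

  fbar-orbit : ∀ s r → suc r ≤ n → fbar n 1 (orbit s r) ≡ orbit s (suc r)
  fbar-orbit false = fbar-orbitA
  fbar-orbit true = fbar-orbitB

  fbar^-base : ∀ s r → r ≤ n → fbar^ r (base s) ≡ orbit s r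
  fbar^-base false zero _ = refl
  fbar^-base true zero _ = refl
  fbar^-base s (suc r) p = trans (cong (fbar n 1) (fbar^-base s r (≤-trans (n≤1+n r) p))) (fbar-orbit s r p)

  -- The absurd patterns below succeed because both sides normalise to lists with different first entries.  When a
  -- block length involves m₀, the list given by σ does not normalise (its range bounds get stuck on m₀ + 1) and runs is used instead.
  runs≢⇒σ⁺≢ : ∀ i a b c {x} → Fits i a b c → runs i a b c ≢ x → σ⁺ i a b ≢ x
  runs≢⇒σ⁺≢ i a b c v ne e = ne (trans (sym (σ≡runs i a b c v)) e)

  σ⁺-suc≢base : ∀ s k a b → σ⁺ (suc k) a b ≢ base s
  σ⁺-suc≢base false k a b ()
  σ⁺-suc≢base true  k a b ()

  orbit-tail≢base : ∀ s s' j → j < m₀ → orbit s (4 + j) ≢ base s'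
  orbit-tail≢base false s' j j< e = σ⁺-suc≢base s' (m₀ ∸ suc j) 0 1 (trans (cong (λ z → σ⁺ z 0 1) (sym (+-∸-assoc 1 j<))) e)
  orbit-tail≢base true  s' j j< e = σ⁺-suc≢base s' (m₀ ∸ suc j) 1 0 (trans (cong (λ z → σ⁺ z 1 0) (sym (+-∸-assoc 1 j<))) e)

  orbit≢base : ∀ s r → 1 ≤ r → r ≤ n → orbit s r ≢ base s
  orbit≢base false 1 _ _ ()
  orbit≢base false 2 _ _ ()
  orbit≢base false 3 _ _ = runs≢⇒σ⁺≢ 0 m₀ 0 1 fits1 λ ()
  orbit≢base true  1 _ _ ()
  orbit≢base true  2 _ _ ()
  orbit≢base true  3 _ _ = runs≢⇒σ⁺≢ 0 m₀ 1 0 fits2 λ ()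
  orbit≢base s (suc (suc (suc (suc j)))) _ p = orbit-tail≢base s s j (jbound j p)

  orbit≢otherBase : ∀ s r → r ≤ n → orbit s r ≢ base (not s)
  orbit≢otherBase false 0 _ ()
  orbit≢otherBase false 1 _ ()
  orbit≢otherBase false 2 _ ()
  orbit≢otherBase false 3 _ = runs≢⇒σ⁺≢ 0 m₀ 0 1 fits1 λ ()
  orbit≢otherBase true  0 _ ()
  orbit≢otherBase true  1 _ ()
  orbit≢otherBase true  2 _ ()
  orbit≢otherBase true  3 _ = runs≢⇒σ⁺≢ 0 m₀ 1 0 fits2 λ ()
  orbit≢otherBase s (suc (suc (suc (suc j)))) p = orbit-tail≢base s (not s) j (jbound j p)

  fbar^-fixes-base : ∀ s r → r ≤ n → fbar^ r (base s) ≡ base s → r ≡ 0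
  fbar^-fixes-base s zero _ _ = refl
  fbar^-fixes-base s (suc r) p e = ⊥-elim (orbit≢base s (suc r) (s≤s z≤n) p (trans (sym (fbar^-base s (suc r) p)) e))

  fbar^-base≢otherBase : ∀ s Y → fbar^ Y (base s) ≢ base (not s)
  fbar^-base≢otherBase s Y e = orbit≢otherBase s (Y % N) (%≤ Y) (trans (sym (fbar^-base s (Y % N) (%≤ Y))) (trans (sym (fbar^-%N (base-perm s) Y)) e))

  fbar^-fixing-base : ∀ s a {π} → Perm π → fbar^ a (base s) ≡ base s → fbar^ a π ≡ π
  fbar^-fixing-base s a {π} pπ e = begin
    fbar^ a π        ≡⟨ fbar^-%N pπ a ⟩
    fbar^ (a % N) π  ≡⟨ cong (λ z → fbar^ z π) (fbar^-fixes-base s (a % N) (%≤ a) (trans (sym (fbar^-%N (base-perm s) a)) e)) ⟩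
    π                ∎
    where open ≡-Reasoning

  reflection-moves-orbit : ∀ s a k → fbar^ a (grev n (fbar^ k (base s))) ≢ fbar^ k (base s)
  reflection-moves-orbit s a k e = fbar^-base≢otherBase (not s) (k * n + (a + X)) (begin
    fbar^ (k * n + (a + X)) (base (not s))         ≡⟨ fbar^-+ (k * n) (a + X) (base (not s)) ⟩
    fbar^ (k * n) (fbar^ (a + X) (base (not s)))   ≡⟨ cong (fbar^ (k * n)) (fbar^-+ a X (base (not s))) ⟩
    fbar^ (k * n) (fbar^ a (fbar^ X (base (not s)))) ≡⟨ cong (λ z → fbar^ (k * n) (fbar^ a z)) (sym (grev-orbit s k)) ⟩
    fbar^ (k * n) (fbar^ a (grev n (fbar^ k (base s)))) ≡⟨ cong (fbar^ (k * n)) e ⟩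
    fbar^ (k * n) (fbar^ k (base s))               ≡⟨ fbar^-cancel k (base-perm s) ⟩
    base s                                         ≡⟨ cong base (sym (not-involutive s)) ⟩
    base (not (not s))                             ∎)
    where
    open ≡-Reasoning
    X = k * n + K

  free : ∀ d v → InD n d → v ∈ V n → d v ≡ v → ∀ π → Sym n π → d π ≡ π
  free d v D v∈ dv≡v π sπ with InD⇒IsWord D | InV⇒orbit (∈V⇒InV v∈)
  ... | a , false , d≗ | k , s , refl = trans (d≗ π sπ) (fbar^-fixing-base s a (Sym⇒Perm sπ) fixes)
    where
    fixes : fbar^ a (base s) ≡ base s
    fixes = fbar^-cancelˡ k (fbar^-perm (base-perm s) a) (base-perm s)
              (trans (fbar^-comm k a (base s)) (trans (sym (d≗ v (InV-Sym (∈V⇒InV v∈)))) dv≡v))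
  ... | a , true , d≗ | k , s , refl =
    ⊥-elim (reflection-moves-orbit s a k (trans (sym (d≗ v (InV-Sym (∈V⇒InV v∈)))) dv≡v))


V-invariant : (n : ℕ) → 3 ≤ n → ((r : ℕ) → r ≤ n → MapsOnto n (fbar n r)) × MapsOnto n (grev n)
V-invariant (suc (suc (suc m₀))) (s≤s (s≤s (s≤s _))) = mapsOnto-fbar , mapsOnto-grev
  where open VertexSet m₀

D-regular-and-Γ-vertexTransitive : (n : ℕ) → 5 ≤ n → ActsRegularly n × VertexTransitiveΓV n
D-regular-and-Γ-vertexTransitive (suc (suc (suc (suc (suc m₁))))) (s≤s (s≤s (s≤s (s≤s (s≤s _))))) =
  (transitive , free) , vertexTransitive
  where open Regularity m₁

lemma9 : ((n : ℕ) → 3 ≤ n →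
           ((r : ℕ) → r ≤ n → MapsOnto n (fbar n r)) × MapsOnto n (grev n))
         × ((n : ℕ) → 5 ≤ n → ActsRegularly n × VertexTransitiveΓV n)
lemma9 = V-invariant , D-regular-and-Γ-vertexTransitive
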